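{- Let $M$ be a matroid on $[n]$ of rank $r\geq2$ and $\mathbf a=(a_1,\dots,a_n)\in\mathbb R^n_{>0}$, $\ell_{\mathbf a}=a_1\partial_1+\dots+a_n\partial_n$. (i) Let $i,j\in[n]$ be non-loops and assume $\dim_{\mathbb R}R^1_{f_M}\ge3$. If $i$ and $j$ are not parallel, then $\ell_{\mathbf a},\partial_i,\partial_j$ are $\mathbb R$-linearly independent in $R_{f_M}$. (ii) If $M\ne U_{r,n}$, then $\partial_0,\ell_{\mathbf a}$ are $\mathbb R$-linearly independent in $R_{\overline P_M}$.
   Context: $f_M=\sum_{B\in\mathcal B(M)}\prod_{i\in B}x_i$; $P_M=\sum_{I\in\mathcal I(M)}\big(\prod_{i\in I}x_i\big)x_0^{n-|I|}$; $\overline P_M=\partial_0^{\,n-r}P_M$. For a homogeneous polynomial $g$, $R_g=S/\{D\in S:Dg=0\}$ where $S$ is the polynomial ring in the operators $\partial_i=\partial/\partial x_i$ (indices $1,\dots,n$ for $f_M$, $0,\dots,n$ for $\overline P_M$), graded by degree. $U_{r,n}$ is the uniform matroid whose bases are all $r$-subsets of $[n]$. -}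

module Defs where

open import Level using (Level; _⊔_) renaming (suc to lsuc)
open import Data.Nat as ℕ using (ℕ; zero; _∸_; _<_)
import Data.Nat.Properties as ℕP
open import Data.Bool using (Bool; true; false; T; _∧_; if_then_else_)
import Data.Bool.Properties as BoolP
open import Data.Fin using (Fin; zero; suc)
open import Data.Fin.Subset using (Subset; ⊥; ⁅_⁆; _∪_; _⊆_; ∣_∣; _∈_; _∉_; inside; outside)
open import Data.Fin.Subset.Properties using (_⊆?_; anySubset?)
open import Data.Vec using (Vec; []; _∷_; lookup; _[_]%=_)
import Data.Vec.Properties as VecP
open import Data.Maybe using (Maybe; just; nothing)
open import Data.Product using (Σ; ∃; _×_; _,_)
open import Data.Sum using (_⊎_)
open import Relation.Nullary using (¬_; Dec; yes; no; does)
open import Relation.Nullary.Decidable using (_×-dec_; ¬?; _→-dec_)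
open import Relation.Binary.PropositionalEquality using (_≡_; _≢_)
open import Relation.Binary using (Rel; IsStrictTotalOrder)
open import Algebra.Bundles using (CommutativeRing)

-- The real numbers, axiomatised as a Dedekind-complete ordered field.
-- (Any model is isomorphic to ℝ; the theorem quantifies over all models.)

record Reals (c ℓ₁ ℓ₂ : Level) : Set (lsuc (c ⊔ ℓ₁ ⊔ ℓ₂)) where
  field
    commutativeRing : CommutativeRing c ℓ₁
  open CommutativeRing commutativeRing public
  field
    _<ᵣ_ : Rel Carrier ℓ₂
    <-isStrictTotalOrder : IsStrictTotalOrder _≈_ _<ᵣ_
    0≉1 : ¬ (0# ≈ 1#)
    inverse : ∀ x → ¬ (x ≈ 0#) → ∃ λ y → (x * y) ≈ 1#
    +-mono-< : ∀ {x y} z → x <ᵣ y → (x + z) <ᵣ (y + z)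
    *-pos : ∀ {x y} → 0# <ᵣ x → 0# <ᵣ y → 0# <ᵣ (x * y)
  _≤ᵣ_ : Carrier → Carrier → Set (ℓ₁ ⊔ ℓ₂)
  x ≤ᵣ y = (x <ᵣ y) ⊎ (x ≈ y)
  field
    lub : (S : Carrier → Set c) → ∃ S → (∃ λ u → ∀ x → S x → x ≤ᵣ u) →
          ∃ λ s → (∀ x → S x → x ≤ᵣ s) × (∀ u → (∀ x → S x → x ≤ᵣ u) → s ≤ᵣ u)

-- Matroids on [n] = Fin n, given by their independent sets.

record Matroid (n : ℕ) : Set where
  field
    indep : Subset n → Bool
    indep-⊥ : T (indep ⊥)
    indep-hereditary : ∀ {I J} → I ⊆ J → T (indep J) → T (indep I)
    indep-augment : ∀ {I J} → T (indep I) → T (indep J) → ∣ I ∣ < ∣ J ∣ →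
                    ∃ λ x → x ∈ J × x ∉ I × T (indep (I ∪ ⁅ x ⁆))

module _ {n : ℕ} (M : Matroid n) where
  open Matroid M

  Indep : Subset n → Set
  Indep I = T (indep I)

  indep? : ∀ I → Dec (Indep I)
  indep? I = BoolP.T? (indep I)

  IsBasis : Subset n → Set
  IsBasis B = Indep B × ¬ (∃ λ B′ → B ⊆ B′ × Indep B′ × B′ ≢ B)

  isBasis? : ∀ B → Dec (IsBasis B)
  isBasis? B = indep? B ×-dec ¬? (anySubset? (λ B′ → (B ⊆? B′) ×-dec (indep? B′ ×-dec ¬? (VecP.≡-dec BoolP._≟_ B′ B))))

  HasRank : ℕ → Set
  HasRank r = ∃ λ B → IsBasis B × ∣ B ∣ ≡ r

  IsLoop : Fin n → Set
  IsLoop i = ¬ Indep ⁅ i ⁆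

  Parallel : Fin n → Fin n → Set
  Parallel i j = i ≡ j ⊎ ¬ Indep (⁅ i ⁆ ∪ ⁅ j ⁆)

  -- M equals the uniform matroid U_{r,n}: its bases are exactly the r-subsets
  IsUniform : ℕ → Set
  IsUniform r = ∀ B → (IsBasis B → ∣ B ∣ ≡ r) × (∣ B ∣ ≡ r → IsBasis B)

-- Exponent vectors that are 0/1 vectors correspond to subsets.

toSubset : ∀ {n} → Vec ℕ n → Maybe (Subset n)
toSubset [] = just []
toSubset (e ∷ es) with toSubset es
... | nothing = nothing
... | just S with e
...   | 0 = just (outside ∷ S)
...   | 1 = just (inside ∷ S)
...   | _ = nothing

module Poly {c ℓ₁ ℓ₂} (ℝ : Reals c ℓ₁ ℓ₂) where
  open Reals ℝ public using (Carrier; _≈_; _+_; _*_; 0#; 1#; _<ᵣ_)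

  -- polynomial in variables indexed by Fin m: coefficient of x^e
  Pol : ℕ → Set c
  Pol m = Vec ℕ m → Carrier

  fromℕ : ℕ → Carrier
  fromℕ zero = 0#
  fromℕ (ℕ.suc k) = 1# + fromℕ k

  ∂ : ∀ {m} → Fin m → Pol m → Pol m
  ∂ k p e = fromℕ (ℕ.suc (lookup e k)) * p (e [ k ]%= ℕ.suc)

  iter : ∀ {A : Set c} → ℕ → (A → A) → A → A
  iter zero f x = x
  iter (ℕ.suc k) f x = f (iter k f x)

  ΣFin : ∀ {m} → (Fin m → Carrier) → Carrier
  ΣFin {zero} f = 0#
  ΣFin {ℕ.suc m} f = f zero + ΣFin (λ i → f (suc i))

  linOp : ∀ {m} → (Fin m → Carrier) → Pol m → Pol m
  linOp v p e = ΣFin (λ k → v k * ∂ k p e)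

  IsZero : ∀ {m} → Pol m → Set ℓ₁
  IsZero p = ∀ e → p e ≈ 0#

  -- unit vector (coefficients of ∂_i)
  unit : ∀ {m} → Fin m → Fin m → Carrier
  unit i j with Data.Fin._≟_ i j
  ... | yes _ = 1#
  ... | no _ = 0#

  -- the classes of the degree-1 operators v_1,...,v_k in R_g are linearly
  -- independent: a linear combination lies in Ann(g) only if trivial
  -- (in degree 1, the class of D in R_g is 0 iff D g = 0)
  LinIndepIn : ∀ {m k} → Pol m → (Fin k → Fin m → Carrier) → Set (c ⊔ ℓ₁)
  LinIndepIn g v = ∀ (cs : Fin _ → Carrier) →
    IsZero (linOp (λ j → ΣFin (λ t → cs t * v t j)) g) → ∀ t → cs t ≈ 0#

  Dim1≥3 : ∀ {m} → Pol m → Set (c ⊔ ℓ₁)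
  Dim1≥3 {m} g = ∃ λ (v : Fin 3 → Fin m → Carrier) → LinIndepIn g v

  f : ∀ {n} → Matroid n → Pol n
  f M e with toSubset e
  ... | nothing = 0#
  ... | just B = if does (isBasis? M B) then 1# else 0#

  -- P_M in variables x_0 (index zero), x_1..x_n (index suc i)
  P : ∀ {n} → Matroid n → Pol (ℕ.suc n)
  P {n} M (e₀ ∷ e) with toSubset e
  ... | nothing = 0#
  ... | just I = if does (indep? M I) ∧ does (ℕ._≟_ e₀ (n ∸ ∣ I ∣)) then 1# else 0#

  Pbar : ∀ {n} → Matroid n → ℕ → Pol (ℕ.suc n)
  Pbar {n} M r = iter (n ∸ r) (∂ zero) (P M)

  ℓ : ∀ {n} → (Fin n → Carrier) → Fin n → Carrier
  ℓ a = a

  ℓ₀ : ∀ {n} → (Fin n → Carrier) → Fin (ℕ.suc n) → Carrier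
  ℓ₀ a zero = 0#
  ℓ₀ a (suc i) = a i

  three : ∀ {m} → (Fin m → Carrier) → (Fin m → Carrier) → (Fin m → Carrier) → Fin 3 → Fin m → Carrier
  three u v w zero = u
  three u v w (suc zero) = v
  three u v w (suc (suc zero)) = w

  two : ∀ {m} → (Fin m → Carrier) → (Fin m → Carrier) → Fin 2 → Fin m → Carrier
  two u v zero = u
  two u v (suc zero) = v

module Submission where

open import Defs
open import Level using (Level)
open import Data.Nat using (ℕ; _≤_)
open import Data.Fin using (Fin; zero)
open import Data.Product using (_×_)
open import Relation.Nullary using (¬_)

import Algebra.Properties.Ring as RingProperties
import Algebra.Properties.CommutativeSemigroup as CommutativeSemigroupProperties
open import Data.Bool using (true; false; if_then_else_; _∧_)
open import Data.Empty using (⊥-elim)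
open import Function using (_∘_)
open import Data.Fin using (suc) renaming (_≟_ to _≟ᶠ_)
open import Data.Fin.Properties using (suc-injective; any?)
open import Data.Fin.Subset using (Subset; ⊥; ⁅_⁆; _∪_; _⊆_; ∁; ∣_∣; _∈_; _∉_; Nonempty; inside; outside)
  renaming (_-_ to _∖_)
open import Data.Fin.Subset.Properties
  using (_∈?_; ∉⊥; ∣⊥∣≡0; ∣p∣≤n; ∣⁅x⁆∣≡1; ∣∁p∣≡n∸∣p∣; x∈⁅x⁆; x∈⁅y⁆⇒x≡y; x≢y⇒x∉⁅y⁆;
         x∈p∪q⁻; x∈p∪q⁺; p⊆p∪q; q⊆p∪q; ∪-comm; ∪-identityˡ; ∪-identityʳ; ⊆-antisym; p⊂q⇒∣p∣<∣q∣;
         x∈p∧x≢y⇒x∈p-y; p─q⊆p; p─⊥≡p; x∉p⇒x∈∁p)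
open import Data.Maybe using (just; nothing)
open import Data.Nat as ℕ using (zero; suc; _<_; z≤n; s≤s; _∸_)
import Data.Nat.Properties as ℕP
open import Data.Product using (∃; _,_; proj₁; proj₂)
open import Data.Sum using (_⊎_; inj₁; inj₂)
open import Data.Vec using (Vec; []; _∷_; lookup; _[_]%=_; here; there)
import Data.Vec.Properties as VecP
open import Relation.Binary using (tri<; tri≈; tri>)
open import Relation.Binary.Structures using (IsStrictTotalOrder)
open import Relation.Binary.PropositionalEquality as ≡ using (_≡_; _≢_)
open import Relation.Nullary using (Dec; yes; no; does)
open import Relation.Nullary.Decidable using (dec-true; dec-false; decidable-stable; ¬?; _×-dec_; _⊎-dec_)

-- Each part reads off the coefficients of a vanishing degree-one operator at
-- square-free monomials: at x^S, ∂ₖ f_M is the indicator of "k ∉ S and S ∪ {k}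
-- is a basis", and ∂ₖ P̄_M (at x₀^{r-1-|S|} x^S) that of "S ∪ {k} is independent".
-- (i)  Let c₀ℓ_a + c₁∂ᵢ + c₂∂ⱼ annihilate f_M.  For r ≥ 3 the sets B-m, B-i, B-j
--      (B ⊇ {i,j} a basis, m ∈ B a third element) force c₀ = c₁ = c₂ = 0; for r = 2
--      and some k parallel to neither i nor j, the sets {i}, {j}, {k} do.  Otherwise
--      every operator vanishing at x^{i} and x^{j} annihilates f_M, so dim R¹ ≤ 2.
-- (ii) Let c₀∂₀ + c₁ℓ_a annihilate P̄_M.  Then c₀(n-|J|) + c₁A(J) = 0 for every
--      independent J with |J| < r, where A(J) = Σ aₖ over the k ∉ J extending J.
--      If c₁ = 0 then c₀ = 0; otherwise A(J) = (n-|J|)ρ, and comparing sums term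
--      by term shows that all weights equal ρ and that every such J extends by
--      every element, so M = U_{r,n}.

module OrderedField {c ℓ₁ ℓ₂} (ℝ : Reals c ℓ₁ ℓ₂) where
  open Reals ℝ public hiding (zero)
  open Poly ℝ public using (fromℕ; ΣFin)
  open IsStrictTotalOrder <-isStrictTotalOrder public
    using (compare; <-respʳ-≈; <-respˡ-≈) renaming (irrefl to <-irrefl; trans to <-trans)
  open RingProperties ring public
    using (-0#≈0#; -‿involutive; -‿distribˡ-*; -‿distribʳ-*; +-inverseʳ-unique; +-cancelʳ; x≈y⇒x∙y⁻¹≈ε; x∙y⁻¹≈ε⇒x≈y)
  open CommutativeSemigroupProperties +-commutativeSemigroup public using (interchange)
  open CommutativeSemigroupProperties *-commutativeSemigroup public using (x∙yz≈y∙xz; x∙yz≈z∙yx)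
  open import Relation.Binary.Reasoning.Setoid setoid public

  _≟ᵣ_ : ∀ x y → Dec (x ≈ y)
  x ≟ᵣ y with compare x y
  ... | tri< _ x≉y _ = no x≉y
  ... | tri≈ _ x≈y _ = yes x≈y
  ... | tri> _ x≉y _ = no x≉y

  <⇒≉ : ∀ {x y} → x <ᵣ y → ¬ (x ≈ y)
  <⇒≉ x<y x≈y = <-irrefl x≈y x<y

  ≤-resp-≈ : ∀ {x x′ y y′} → x ≈ x′ → y ≈ y′ → x ≤ᵣ y → x′ ≤ᵣ y′
  ≤-resp-≈ x≈x′ y≈y′ (inj₁ x<y) = inj₁ (<-respˡ-≈ x≈x′ (<-respʳ-≈ y≈y′ x<y))
  ≤-resp-≈ x≈x′ y≈y′ (inj₂ x≈y) = inj₂ (trans (sym x≈x′) (trans x≈y y≈y′))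

  <-≤-trans : ∀ {x y z} → x <ᵣ y → y ≤ᵣ z → x <ᵣ z
  <-≤-trans x<y (inj₁ y<z) = <-trans x<y y<z
  <-≤-trans x<y (inj₂ y≈z) = <-respʳ-≈ y≈z x<y

  +-monoˡ-≤ : ∀ {x y} z → x ≤ᵣ y → (x + z) ≤ᵣ (y + z)
  +-monoˡ-≤ z (inj₁ x<y) = inj₁ (+-mono-< z x<y)
  +-monoˡ-≤ z (inj₂ x≈y) = inj₂ (+-cong x≈y refl)

  +-mono-<-≤ : ∀ {x y u v} → x <ᵣ y → u ≤ᵣ v → (x + u) <ᵣ (y + v)
  +-mono-<-≤ {x} {y} {u} {v} x<y u≤v =
    <-≤-trans (+-mono-< u x<y) (≤-resp-≈ (+-comm u y) (+-comm v y) (+-monoˡ-≤ y u≤v))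

  +-mono-≤ : ∀ {x y u v} → x ≤ᵣ y → u ≤ᵣ v → (x + u) ≤ᵣ (y + v)
  +-mono-≤ (inj₁ x<y) u≤v = inj₁ (+-mono-<-≤ x<y u≤v)
  +-mono-≤ {x} {y} {u} {v} (inj₂ x≈y) u≤v =
    ≤-resp-≈ (+-comm u x) (trans (+-comm v x) (+-cong x≈y refl)) (+-monoˡ-≤ x u≤v)

  x+y-y≈x : ∀ x y → (x + y) + - y ≈ x
  x+y-y≈x x y = trans (+-assoc x y (- y)) (trans (+-cong refl (-‿inverseʳ y)) (+-identityʳ x))

  +-cancelʳ-≤ : ∀ {x y} z → (x + z) ≤ᵣ (y + z) → x ≤ᵣ y
  +-cancelʳ-≤ {x} {y} z le = ≤-resp-≈ (x+y-y≈x x z) (x+y-y≈x y z) (+-monoˡ-≤ (- z) le)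

  *-monoˡ-< : ∀ {c x y} → 0# <ᵣ c → x <ᵣ y → (c * x) <ᵣ (c * y)
  *-monoˡ-< {c} {x} {y} 0<c x<y = <-respˡ-≈ (+-identityˡ (c * x)) (<-respʳ-≈ cy-cx+cx≈cy (+-mono-< (c * x) 0<c[y-x]))
    where
    0<c[y-x] : 0# <ᵣ (c * (y + - x))
    0<c[y-x] = *-pos 0<c (<-respˡ-≈ (-‿inverseʳ x) (+-mono-< (- x) x<y))
    cy-cx+cx≈cy : c * (y + - x) + c * x ≈ c * y
    cy-cx+cx≈cy = begin
      c * (y + - x) + c * x ≈⟨ sym (distribˡ c (y + - x) x) ⟩
      c * ((y + - x) + x)   ≈⟨ *-cong refl (trans (+-assoc y (- x) x) (trans (+-cong refl (-‿inverseˡ x)) (+-identityʳ y))) ⟩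
      c * y                 ∎

  *-monoˡ-≤ : ∀ {c x y} → 0# ≤ᵣ c → x ≤ᵣ y → (c * x) ≤ᵣ (c * y)
  *-monoˡ-≤ (inj₁ 0<c) (inj₁ x<y) = inj₁ (*-monoˡ-< 0<c x<y)
  *-monoˡ-≤ {c} {x} {y} (inj₂ 0≈c) (inj₁ _) =
    inj₂ (trans (*-cong (sym 0≈c) refl) (trans (zeroˡ x) (sym (trans (*-cong (sym 0≈c) refl) (zeroˡ y)))))
  *-monoˡ-≤ _ (inj₂ x≈y) = inj₂ (*-cong refl x≈y)

  *-nonneg : ∀ {x y} → 0# ≤ᵣ x → 0# ≤ᵣ y → 0# ≤ᵣ (x * y)
  *-nonneg {x} 0≤x 0≤y = ≤-resp-≈ (zeroʳ x) refl (*-monoˡ-≤ 0≤x 0≤y)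

  -- 0 < 1: otherwise -1 > 0, and then 1 = (-1)(-1) > 0.
  0<1 : 0# <ᵣ 1#
  0<1 with compare 0# 1#
  ... | tri< 0<1 _ _ = 0<1
  ... | tri≈ _ 0≈1 _ = ⊥-elim (0≉1 0≈1)
  ... | tri> _ _ 1<0 = ⊥-elim (<-irrefl refl (<-trans 1<0 0<1′))
    where
    0<-1 : 0# <ᵣ (- 1#)
    0<-1 = <-respˡ-≈ (-‿inverseʳ 1#) (<-respʳ-≈ (+-identityˡ (- 1#)) (+-mono-< (- 1#) 1<0))
    0<1′ : 0# <ᵣ 1#
    0<1′ = <-respʳ-≈ (trans (sym (-‿distribˡ-* 1# (- 1#))) (trans (-‿cong (*-identityˡ (- 1#))) (-‿involutive 1#)))
                      (*-pos 0<-1 0<-1)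

  fromℕ-nonneg : ∀ k → 0# ≤ᵣ fromℕ k
  fromℕ-nonneg zero = inj₂ refl
  fromℕ-nonneg (suc k) = ≤-resp-≈ (+-identityʳ 0#) refl (+-mono-≤ (inj₁ 0<1) (fromℕ-nonneg k))

  fromℕ-pos : ∀ {k} → 0 < k → 0# <ᵣ fromℕ k
  fromℕ-pos {suc k} _ = <-respˡ-≈ (+-identityʳ 0#) (+-mono-<-≤ 0<1 (fromℕ-nonneg k))

  1≉0 : ¬ (1# ≈ 0#)
  1≉0 1≈0 = 0≉1 (sym 1≈0)

  -x≈0⇒x≈0 : ∀ {x} → - x ≈ 0# → x ≈ 0#
  -x≈0⇒x≈0 {x} -x≈0 = trans (sym (-‿involutive x)) (trans (-‿cong -x≈0) -0#≈0#)

  cancelʳ : ∀ {x y} → x * y ≈ 0# → ¬ (y ≈ 0#) → x ≈ 0#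
  cancelʳ {x} {y} xy≈0 y≉0 with inverse y y≉0
  ... | z , yz≈1 = begin
    x            ≈⟨ sym (*-identityʳ x) ⟩
    x * 1#       ≈⟨ *-cong refl (sym yz≈1) ⟩
    x * (y * z)  ≈⟨ sym (*-assoc x y z) ⟩
    (x * y) * z  ≈⟨ *-cong xy≈0 refl ⟩
    0# * z       ≈⟨ zeroˡ z ⟩
    0#           ∎

  cancelˡ : ∀ {x y} → y * x ≈ 0# → ¬ (y ≈ 0#) → x ≈ 0#
  cancelˡ {x} {y} yx≈0 = cancelʳ (trans (*-comm x y) yx≈0)

  *-cancel-≉ : ∀ {c x y} → c * x ≈ c * y → ¬ (x ≈ y) → c ≈ 0#
  *-cancel-≉ {c} {x} {y} cx≈cy x≉y = cancelʳ c[x-y]≈0 (x≉y ∘ x∙y⁻¹≈ε⇒x≈y x y)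
    where
    c[x-y]≈0 : c * (x + - y) ≈ 0#
    c[x-y]≈0 = trans (distribˡ c x (- y)) (trans (+-cong refl (sym (-‿distribʳ-* c y))) (x≈y⇒x∙y⁻¹≈ε cx≈cy))

  Σ-cong : ∀ {m} {g h : Fin m → Carrier} → (∀ k → g k ≈ h k) → ΣFin g ≈ ΣFin h
  Σ-cong {zero} eq = refl
  Σ-cong {suc m} eq = +-cong (eq zero) (Σ-cong (λ k → eq (suc k)))

  Σ-+ : ∀ {m} (g h : Fin m → Carrier) → ΣFin (λ k → g k + h k) ≈ ΣFin g + ΣFin h
  Σ-+ {zero} g h = sym (+-identityʳ 0#)
  Σ-+ {suc m} g h = trans (+-cong refl (Σ-+ (λ k → g (suc k)) (λ k → h (suc k)))) (interchange _ _ _ _)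

  Σ-* : ∀ {m} x (g : Fin m → Carrier) → ΣFin (λ k → x * g k) ≈ x * ΣFin g
  Σ-* {zero} x g = sym (zeroʳ x)
  Σ-* {suc m} x g = trans (+-cong refl (Σ-* x (λ k → g (suc k)))) (sym (distribˡ x (g zero) _))

  Σ-0 : ∀ {m} → ΣFin {m} (λ _ → 0#) ≈ 0#
  Σ-0 {zero} = refl
  Σ-0 {suc m} = trans (+-cong refl (Σ-0 {m})) (+-identityʳ 0#)

  Σ-const : ∀ {m} x → ΣFin {m} (λ _ → x) ≈ fromℕ m * x
  Σ-const {zero} x = sym (zeroˡ x)
  Σ-const {suc m} x = trans (+-cong (sym (*-identityˡ x)) (Σ-const {m} x)) (sym (distribʳ x 1# (fromℕ m)))

  Σ-swap : ∀ {m k} (h : Fin k → Fin m → Carrier) →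
           ΣFin (λ j → ΣFin (λ t → h t j)) ≈ ΣFin (λ t → ΣFin (λ j → h t j))
  Σ-swap {zero} {k} h = sym (Σ-0 {k})
  Σ-swap {suc m} h = trans (+-cong refl (Σ-swap (λ t j → h t (suc j))))
                           (sym (Σ-+ (λ t → h t zero) (λ t → ΣFin (λ j → h t (suc j)))))

  Σ-mono-≤ : ∀ {m} {g h : Fin m → Carrier} → (∀ k → g k ≤ᵣ h k) → ΣFin g ≤ᵣ ΣFin h
  Σ-mono-≤ {zero} g≤h = inj₂ refl
  Σ-mono-≤ {suc m} g≤h = +-mono-≤ (g≤h zero) (Σ-mono-≤ (λ k → g≤h (suc k)))

  Σ-mono-< : ∀ {m} {g h : Fin m → Carrier} → (∀ k → g k ≤ᵣ h k) → ∀ l → g l <ᵣ h l → ΣFin g <ᵣ ΣFin h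
  Σ-mono-< g≤h zero gl<hl = +-mono-<-≤ gl<hl (Σ-mono-≤ (λ k → g≤h (suc k)))
  Σ-mono-< g≤h (suc l) gl<hl =
    <-respˡ-≈ (+-comm _ _) (<-respʳ-≈ (+-comm _ _) (+-mono-<-≤ (Σ-mono-< (λ k → g≤h (suc k)) l gl<hl) (g≤h zero)))

  Σ-≤-≈ : ∀ {m} {g h : Fin m → Carrier} → (∀ k → g k ≤ᵣ h k) → ΣFin g ≈ ΣFin h → ∀ k → g k ≈ h k
  Σ-≤-≈ g≤h Σg≈Σh k with g≤h k
  ... | inj₂ gk≈hk = gk≈hk
  ... | inj₁ gk<hk = ⊥-elim (<⇒≉ (Σ-mono-< g≤h k gk<hk) Σg≈Σh)

module Operators {c ℓ₁ ℓ₂} (ℝ : Reals c ℓ₁ ℓ₂) where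
  open OrderedField ℝ
  open Poly ℝ using (Pol; ∂; linOp; unit)

  ≡⇒≈ : ∀ {x y} → x ≡ y → x ≈ y
  ≡⇒≈ ≡.refl = refl

  Σ-single : ∀ {m} (i : Fin m) (g : Fin m → Carrier) → (∀ k → k ≢ i → g k ≈ 0#) → ΣFin g ≈ g i
  Σ-single {suc m} zero g g≈0 = trans (+-cong refl (trans (Σ-cong (λ k → g≈0 (suc k) (λ ()))) (Σ-0 {m}))) (+-identityʳ _)
  Σ-single (suc i) g g≈0 =
    trans (+-cong (g≈0 zero (λ ())) (Σ-single i (λ k → g (suc k)) (λ k k≢i → g≈0 (suc k) (λ e → k≢i (suc-injective e)))))
          (+-identityˡ _)

  unit-≡ : ∀ {m} (i : Fin m) → unit i i ≈ 1#
  unit-≡ i with i ≟ᶠ i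
  ... | yes _ = refl
  ... | no i≢i = ⊥-elim (i≢i ≡.refl)

  unit-≢ : ∀ {m} {i k : Fin m} → k ≢ i → unit i k ≈ 0#
  unit-≢ {i = i} {k} k≢i with i ≟ᶠ k
  ... | yes i≡k = ⊥-elim (k≢i (≡.sym i≡k))
  ... | no _ = refl

  Σ-unit : ∀ {m} (i : Fin m) (g : Fin m → Carrier) → ΣFin (λ k → unit i k * g k) ≈ g i
  Σ-unit i g = trans (Σ-single i _ (λ k k≢i → trans (*-cong (unit-≢ k≢i) refl) (zeroˡ (g k))))
                     (trans (*-cong (unit-≡ i) refl) (*-identityˡ (g i)))

  linOp-unit : ∀ {m} (i : Fin m) (g : Pol m) e → linOp (unit i) g e ≈ ∂ i g e
  linOp-unit i g e = Σ-unit i (λ k → ∂ k g e)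

  linOp-combination : ∀ {m k} (cs : Fin k → Carrier) (v : Fin k → Fin m → Carrier) (g : Pol m) e →
    linOp (λ j → ΣFin (λ t → cs t * v t j)) g e ≈ ΣFin (λ t → cs t * linOp (v t) g e)
  linOp-combination cs v g e = begin
    ΣFin (λ j → ΣFin (λ t → cs t * v t j) * ∂ j g e)
      ≈⟨ Σ-cong (λ j → trans (*-comm _ (∂ j g e)) (sym (Σ-* (∂ j g e) (λ t → cs t * v t j)))) ⟩
    ΣFin (λ j → ΣFin (λ t → ∂ j g e * (cs t * v t j)))
      ≈⟨ Σ-swap (λ t j → ∂ j g e * (cs t * v t j)) ⟩
    ΣFin (λ t → ΣFin (λ j → ∂ j g e * (cs t * v t j)))
      ≈⟨ Σ-cong (λ t → trans (Σ-cong (λ j → trans (*-comm _ _) (*-assoc (cs t) (v t j) (∂ j g e))))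
                             (Σ-* (cs t) (λ j → v t j * ∂ j g e))) ⟩
    ΣFin (λ t → cs t * linOp (v t) g e) ∎

  indicator : ∀ {m} → Subset m → Fin m → Carrier
  indicator p k = if lookup p k then 1# else 0#

  indicator-∈ : ∀ {m} {p : Subset m} {k} → k ∈ p → indicator p k ≈ 1#
  indicator-∈ k∈p rewrite VecP.[]=⇒lookup k∈p = refl

  indicator-nonneg : ∀ {m} (p : Subset m) k → 0# ≤ᵣ indicator p k
  indicator-nonneg p k with lookup p k
  ... | true = inj₁ 0<1
  ... | false = inj₂ refl

  Σ-indicator : ∀ {m} (p : Subset m) x → ΣFin (λ k → indicator p k * x) ≈ fromℕ ∣ p ∣ * x
  Σ-indicator [] x = sym (zeroˡ x)
  Σ-indicator (true ∷ p) x = trans (+-cong refl (Σ-indicator p x)) (sym (distribʳ x 1# _))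
  Σ-indicator (false ∷ p) x = trans (+-cong (zeroˡ x) (Σ-indicator p x)) (+-identityˡ _)

  pairing : (Fin 3 → Carrier) → (Fin 3 → Carrier) → Carrier
  pairing w cs = ΣFin (λ t → cs t * w t)

  CommonZero : (Fin 3 → Carrier) → (Fin 3 → Carrier) → Set (c Level.⊔ ℓ₁)
  CommonZero α β = ∃ λ cs → pairing α cs ≈ 0# × pairing β cs ≈ 0# × ∃ λ t → ¬ (cs t ≈ 0#)

  pairing-bilinear : ∀ w x y k₁ k₂ → pairing w (λ t → x * k₁ t + y * k₂ t) ≈ x * pairing w k₁ + y * pairing w k₂
  pairing-bilinear w x y k₁ k₂ = begin
    ΣFin (λ t → (x * k₁ t + y * k₂ t) * w t)
      ≈⟨ Σ-cong (λ t → trans (distribʳ (w t) _ _) (+-cong (*-assoc x (k₁ t) (w t)) (*-assoc y (k₂ t) (w t)))) ⟩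
    ΣFin (λ t → x * (k₁ t * w t) + y * (k₂ t * w t))
      ≈⟨ Σ-+ (λ t → x * (k₁ t * w t)) (λ t → y * (k₂ t * w t)) ⟩
    ΣFin (λ t → x * (k₁ t * w t)) + ΣFin (λ t → y * (k₂ t * w t))
      ≈⟨ +-cong (Σ-* x (λ t → k₁ t * w t)) (Σ-* y (λ t → k₂ t * w t)) ⟩
    x * pairing w k₁ + y * pairing w k₂ ∎

  -- x y - y x = 0, the cancellation behind all the kernel vectors below.
  xy-yx≈0 : ∀ x y → x * y + (- y) * x ≈ 0#
  xy-yx≈0 x y = trans (+-cong refl (trans (sym (-‿distribˡ-* y x)) (-‿cong (*-comm y x)))) (-‿inverseʳ (x * y))

  common-zero-from-echelon : ∀ α β k₁ k₂ t₁ t₂ → pairing α k₁ ≈ 0# → pairing α k₂ ≈ 0# →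
    ¬ (k₁ t₁ ≈ 0#) → k₁ t₂ ≈ 0# → ¬ (k₂ t₂ ≈ 0#) → CommonZero α β
  common-zero-from-echelon α β k₁ k₂ t₁ t₂ αk₁ αk₂ k₁t₁≉0 k₁t₂≈0 k₂t₂≉0 with pairing β k₁ ≟ᵣ 0#
  ... | yes βk₁ = k₁ , αk₁ , βk₁ , t₁ , k₁t₁≉0
  ... | no βk₁≉0 = cs , αcs , βcs , t₂ , cs-t₂≉0
    where
    cs : Fin 3 → Carrier
    cs t = pairing β k₂ * k₁ t + (- pairing β k₁) * k₂ t
    αcs : pairing α cs ≈ 0#
    αcs = trans (pairing-bilinear α _ _ k₁ k₂)
                (trans (+-cong (trans (*-cong refl αk₁) (zeroʳ _)) (trans (*-cong refl αk₂) (zeroʳ _))) (+-identityʳ 0#))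
    βcs : pairing β cs ≈ 0#
    βcs = trans (pairing-bilinear β _ _ k₁ k₂) (xy-yx≈0 (pairing β k₂) (pairing β k₁))
    cs-t₂≉0 : ¬ (cs t₂ ≈ 0#)
    cs-t₂≉0 cs-t₂≈0 =
      k₂t₂≉0 (cancelˡ (trans (sym (trans (+-cong (trans (*-cong refl k₁t₂≈0) (zeroʳ _)) refl) (+-identityˡ _))) cs-t₂≈0)
                                      (λ -βk₁≈0 → βk₁≉0 (-x≈0⇒x≈0 -βk₁≈0)))

  vec3 : Carrier → Carrier → Carrier → Fin 3 → Carrier
  vec3 x y z zero = x
  vec3 x y z (suc zero) = y
  vec3 x y z (suc (suc zero)) = z

  pairing-vec3 : ∀ w x y z → pairing w (vec3 x y z) ≈ x * w zero + (y * w (suc zero) + z * w (suc (suc zero)))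
  pairing-vec3 w x y z = +-cong refl (+-cong refl (+-identityʳ _))

  pairing-e₀ : ∀ α → α zero ≈ 0# → pairing α (vec3 1# 0# 0#) ≈ 0#
  pairing-e₀ α α₀≈0 = trans (pairing-vec3 α _ _ _)
    (trans (+-cong (trans (*-identityˡ _) α₀≈0) (trans (+-cong (zeroˡ _) (zeroˡ _)) (+-identityʳ 0#))) (+-identityʳ 0#))

  -- Echelon pairs of zeros of α: (α₁,-α₀,0), (α₂,0,-α₀) if α₀ ≠ 0; else e₀ with
  -- (0,α₂,-α₁) if α₁ ≠ 0; else e₀, e₁.
  common-zero : ∀ α β → CommonZero α β
  common-zero α β with α zero ≟ᵣ 0# | α (suc zero) ≟ᵣ 0#
  ... | no α₀≉0 | _ =
    common-zero-from-echelon α β (vec3 α₁ (- α₀) 0#) (vec3 α₂ 0# (- α₀)) (suc zero) (suc (suc zero))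
      (trans (pairing-vec3 α _ _ _) (trans (+-cong refl (trans (+-cong refl (zeroˡ α₂)) (+-identityʳ _))) (xy-yx≈0 α₁ α₀)))
      (trans (pairing-vec3 α _ _ _) (trans (+-cong refl (trans (+-cong (zeroˡ α₁) refl) (+-identityˡ _))) (xy-yx≈0 α₂ α₀)))
      (α₀≉0 ∘ -x≈0⇒x≈0) refl (α₀≉0 ∘ -x≈0⇒x≈0)
    where
    α₀ α₁ α₂ : Carrier
    α₀ = α zero
    α₁ = α (suc zero)
    α₂ = α (suc (suc zero))
  ... | yes α₀≈0 | no α₁≉0 =
    common-zero-from-echelon α β (vec3 1# 0# 0#) (vec3 0# α₂ (- α₁)) zero (suc (suc zero))
      (pairing-e₀ α α₀≈0)
      (trans (pairing-vec3 α _ _ _) (trans (+-cong (zeroˡ _) (xy-yx≈0 α₂ α₁)) (+-identityʳ 0#)))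
      1≉0 refl (α₁≉0 ∘ -x≈0⇒x≈0)
    where
    α₁ α₂ : Carrier
    α₁ = α (suc zero)
    α₂ = α (suc (suc zero))
  ... | yes α₀≈0 | yes α₁≈0 =
    common-zero-from-echelon α β (vec3 1# 0# 0#) (vec3 0# 1# 0#) zero (suc zero)
      (pairing-e₀ α α₀≈0)
      (trans (pairing-vec3 α _ _ _)
        (trans (+-cong (zeroˡ _) (trans (+-cong (trans (*-identityˡ _) α₁≈0) (zeroˡ _)) (+-identityʳ 0#))) (+-identityʳ 0#)))
      1≉0 refl 1≉0

module Subsets where

  -- The exponent vector of the square-free monomial ∏_{k ∈ S} x_k.
  exponent : ∀ {n} → Subset n → Vec ℕ n
  exponent [] = []
  exponent (b ∷ S) = (if b then 1 else 0) ∷ exponent S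

  toSubset-exponent : ∀ {n} (S : Subset n) → toSubset (exponent S) ≡ just S
  toSubset-exponent [] = ≡.refl
  toSubset-exponent (true ∷ S) rewrite toSubset-exponent S = ≡.refl
  toSubset-exponent (false ∷ S) rewrite toSubset-exponent S = ≡.refl

  bump-∈ : ∀ {n} (S : Subset n) k → k ∈ S → toSubset (exponent S [ k ]%= suc) ≡ nothing
  bump-∈ (true ∷ S) zero here rewrite toSubset-exponent S = ≡.refl
  bump-∈ (b ∷ S) (suc k) (there k∈S) rewrite bump-∈ S k k∈S = ≡.refl

  bump-∉ : ∀ {n} (S : Subset n) k → k ∉ S → exponent S [ k ]%= suc ≡ exponent (S ∪ ⁅ k ⁆)
  bump-∉ (true ∷ S) zero k∉S = ⊥-elim (k∉S here)
  bump-∉ (false ∷ S) zero k∉S = ≡.cong (λ T → 1 ∷ exponent T) (≡.sym (∪-identityʳ S))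
  bump-∉ (true ∷ S) (suc k) k∉S = ≡.cong (1 ∷_) (bump-∉ S k (k∉S ∘ there))
  bump-∉ (false ∷ S) (suc k) k∉S = ≡.cong (0 ∷_) (bump-∉ S k (k∉S ∘ there))

  lookup-∉ : ∀ {n} (S : Subset n) k → k ∉ S → lookup (exponent S) k ≡ 0
  lookup-∉ (true ∷ S) zero k∉S = ⊥-elim (k∉S here)
  lookup-∉ (false ∷ S) zero k∉S = ≡.refl
  lookup-∉ (b ∷ S) (suc k) k∉S = lookup-∉ S k (k∉S ∘ there)

  toSubset-just : ∀ {n} (e : Vec ℕ n) {S} → toSubset e ≡ just S → e ≡ exponent S
  toSubset-just [] ≡.refl = ≡.refl
  toSubset-just (x ∷ es) eq with toSubset es in eq′
  toSubset-just (x ∷ es) () | nothing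
  toSubset-just (0 ∷ es) ≡.refl | just _ = ≡.cong (0 ∷_) (toSubset-just es eq′)
  toSubset-just (1 ∷ es) ≡.refl | just _ = ≡.cong (1 ∷_) (toSubset-just es eq′)
  toSubset-just (suc (suc x) ∷ es) () | just _

  bump-nothing : ∀ {n} (e : Vec ℕ n) k → toSubset e ≡ nothing → toSubset (e [ k ]%= suc) ≡ nothing
  bump-nothing (x ∷ es) zero eq with toSubset es
  ... | nothing = ≡.refl
  bump-nothing (0 ∷ es) zero () | just _
  bump-nothing (1 ∷ es) zero eq | just _ = ≡.refl
  bump-nothing (suc (suc x) ∷ es) zero eq | just _ = ≡.refl
  bump-nothing (x ∷ es) (suc k) eq with toSubset es in eq₁
  ... | nothing rewrite bump-nothing es k eq₁ = ≡.refl
  bump-nothing (0 ∷ es) (suc k) () | just _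
  bump-nothing (1 ∷ es) (suc k) () | just _
  bump-nothing (suc (suc x) ∷ es) (suc k) eq | just _ with toSubset (es [ k ]%= suc)
  ... | nothing = ≡.refl
  ... | just _ = ≡.refl

  card-add : ∀ {n} (S : Subset n) k → k ∉ S → ∣ S ∪ ⁅ k ⁆ ∣ ≡ suc ∣ S ∣
  card-add (true ∷ S) zero k∉S = ⊥-elim (k∉S here)
  card-add (false ∷ S) zero k∉S = ≡.cong (λ T → suc ∣ T ∣) (∪-identityʳ S)
  card-add (true ∷ S) (suc k) k∉S = ≡.cong suc (card-add S k (k∉S ∘ there))
  card-add (false ∷ S) (suc k) k∉S = card-add S k (k∉S ∘ there)

  x∉p∖x : ∀ {n} x (p : Subset n) → x ∉ p ∖ x
  x∉p∖x zero (b ∷ p) ()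
  x∉p∖x (suc x) (b ∷ p) (there x∈) = x∉p∖x x p x∈

  remove-add : ∀ {n} {x} {p : Subset n} → x ∈ p → (p ∖ x) ∪ ⁅ x ⁆ ≡ p
  remove-add {x = zero} {inside ∷ p} here = ≡.cong (inside ∷_) (≡.trans (∪-identityʳ _) (p─⊥≡p p))
  remove-add {x = suc x} {inside ∷ p} (there x∈p) = ≡.cong (inside ∷_) (remove-add x∈p)
  remove-add {x = suc x} {outside ∷ p} (there x∈p) = ≡.cong (outside ∷_) (remove-add x∈p)

  card-remove : ∀ {n} {x} {p : Subset n} → x ∈ p → suc ∣ p ∖ x ∣ ≡ ∣ p ∣
  card-remove {x = x} {p} x∈p = ≡.trans (≡.sym (card-add (p ∖ x) x (x∉p∖x x p))) (≡.cong ∣_∣ (remove-add x∈p))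

  card-zero : ∀ {n} (S : Subset n) → ∣ S ∣ ≡ 0 → S ≡ ⊥
  card-zero [] _ = ≡.refl
  card-zero (false ∷ S) |S|≡0 = ≡.cong (false ∷_) (card-zero S |S|≡0)

  nonempty : ∀ {n} (S : Subset n) {k} → ∣ S ∣ ≡ suc k → Nonempty S
  nonempty (true ∷ S) _ = zero , here
  nonempty (false ∷ S) |S|≡1+k with nonempty S |S|≡1+k
  ... | x , x∈S = suc x , there x∈S

  singleton-of-card : ∀ {n} (S : Subset n) → ∣ S ∣ ≡ 1 → ∃ λ l → S ≡ ⁅ l ⁆
  singleton-of-card S |S|≡1 with nonempty S |S|≡1
  ... | l , l∈S = l , (begin
    S               ≡⟨ ≡.sym (remove-add l∈S) ⟩
    (S ∖ l) ∪ ⁅ l ⁆  ≡⟨ ≡.cong (_∪ ⁅ l ⁆) (card-zero (S ∖ l) (ℕP.suc-injective (≡.trans (card-remove l∈S) |S|≡1))) ⟩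
    ⊥ ∪ ⁅ l ⁆       ≡⟨ ∪-identityˡ ⁅ l ⁆ ⟩
    ⁅ l ⁆           ∎)
    where open ≡.≡-Reasoning

  pair-card : ∀ {n} {i j : Fin n} → i ≢ j → ∣ ⁅ i ⁆ ∪ ⁅ j ⁆ ∣ ≡ 2
  pair-card {i = i} {j} i≢j = ≡.trans (card-add ⁅ i ⁆ j (x≢y⇒x∉⁅y⁆ (i≢j ∘ ≡.sym))) (≡.cong suc (∣⁅x⁆∣≡1 i))

  ∈-pair : ∀ {n} {i j x : Fin n} → x ∈ ⁅ i ⁆ ∪ ⁅ j ⁆ → x ≡ i ⊎ x ≡ j
  ∈-pair {i = i} {j} x∈ with x∈p∪q⁻ ⁅ i ⁆ ⁅ j ⁆ x∈
  ... | inj₁ x∈i = inj₁ (x∈⁅y⁆⇒x≡y i x∈i)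
  ... | inj₂ x∈j = inj₂ (x∈⁅y⁆⇒x≡y j x∈j)

  ⁅⁆⊆ : ∀ {n} {x : Fin n} {S} → x ∈ S → ⁅ x ⁆ ⊆ S
  ⁅⁆⊆ {x = x} x∈S y∈⁅x⁆ rewrite x∈⁅y⁆⇒x≡y x y∈⁅x⁆ = x∈S

  x∈p∪⁅x⁆ : ∀ {n} (p : Subset n) x → x ∈ p ∪ ⁅ x ⁆
  x∈p∪⁅x⁆ p x = q⊆p∪q p ⁅ x ⁆ (x∈⁅x⁆ x)

  ⊆∧≢⇒∣<∣ : ∀ {n} {p q : Subset n} → p ⊆ q → p ≢ q → ∣ p ∣ < ∣ q ∣
  ⊆∧≢⇒∣<∣ {p = p} {q} p⊆q p≢q with any? (λ x → x ∈? q ×-dec ¬? (x ∈? p))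
  ... | yes (x , x∈q , x∉p) = p⊂q⇒∣p∣<∣q∣ (p⊆q , x , x∈q , x∉p)
  ... | no none = ⊥-elim (p≢q (⊆-antisym p⊆q (λ {x} x∈q → decidable-stable (x ∈? p) (λ x∉p → none (x , x∈q , x∉p)))))

module MatroidFacts {n : ℕ} (M : Matroid n) where
  open Matroid M
  open Subsets

  member-nonloop : ∀ {x S} → Indep M S → x ∈ S → Indep M ⁅ x ⁆
  member-nonloop indep-S x∈S = indep-hereditary (⁅⁆⊆ x∈S) indep-S

  pair-comm : ∀ {x y} → Indep M (⁅ x ⁆ ∪ ⁅ y ⁆) → Indep M (⁅ y ⁆ ∪ ⁅ x ⁆)
  pair-comm {x} {y} = ≡.subst (Indep M) (∪-comm ⁅ x ⁆ ⁅ y ⁆)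

  basis-max : ∀ {B I} → IsBasis M B → Indep M I → ∣ I ∣ ≤ ∣ B ∣
  basis-max {B} {I} (indep-B , maximal) indep-I with ∣ B ∣ ℕP.<? ∣ I ∣
  ... | no |B|≮|I| = ℕP.≮⇒≥ |B|≮|I|
  ... | yes |B|<|I| with indep-augment indep-B indep-I |B|<|I|
  ...   | x , _ , x∉B , indep-B+x =
          ⊥-elim (maximal (B ∪ ⁅ x ⁆ , p⊆p∪q ⁅ x ⁆ , indep-B+x , λ eq → x∉B (≡.subst (x ∈_) eq (x∈p∪⁅x⁆ B x))))

  parallel-sym : ∀ {x y} → Parallel M x y → Parallel M y x
  parallel-sym (inj₁ x≡y) = inj₁ (≡.sym x≡y)
  parallel-sym (inj₂ dependent) = inj₂ (dependent ∘ pair-comm)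

  parallel-trans : ∀ {x y z} → Indep M ⁅ y ⁆ → Parallel M x y → Parallel M y z → Parallel M x z
  parallel-trans _ (inj₁ ≡.refl) y∥z = y∥z
  parallel-trans _ x∥y (inj₁ ≡.refl) = x∥y
  parallel-trans {x} {y} {z} indep-y (inj₂ dep-xy) (inj₂ dep-yz) with x ≟ᶠ z | indep? M (⁅ x ⁆ ∪ ⁅ z ⁆)
  ... | yes x≡z | _ = inj₁ x≡z
  ... | no _ | no dep-xz = inj₂ dep-xz
  ... | no x≢z | yes indep-xz with indep-augment indep-y indep-xz |y|<|xz|
    where
    |y|<|xz| : ∣ ⁅ y ⁆ ∣ < ∣ ⁅ x ⁆ ∪ ⁅ z ⁆ ∣
    |y|<|xz| rewrite ∣⁅x⁆∣≡1 y | pair-card x≢z = s≤s (s≤s z≤n)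
  ...   | w , w∈xz , _ , indep-yw with ∈-pair w∈xz
  ...     | inj₁ ≡.refl = ⊥-elim (dep-xy (pair-comm indep-yw))
  ...     | inj₂ ≡.refl = ⊥-elim (dep-yz indep-yw)

  loop-parallel : ∀ {x} k → IsLoop M x → Parallel M x k
  loop-parallel {x} k loop = inj₂ (λ indep-xk → loop (indep-hereditary (p⊆p∪q ⁅ k ⁆) indep-xk))

  parallel? : ∀ x y → Dec (Parallel M x y)
  parallel? x y = (x ≟ᶠ y) ⊎-dec ¬? (indep? M (⁅ x ⁆ ∪ ⁅ y ⁆))

  nonparallel-pair : ∀ {x y} → ¬ Parallel M x y → x ≢ y × Indep M (⁅ x ⁆ ∪ ⁅ y ⁆)
  nonparallel-pair {x} {y} x∦y = x∦y ∘ inj₁ , decidable-stable (indep? M (⁅ x ⁆ ∪ ⁅ y ⁆)) (x∦y ∘ inj₂)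

  nonparallel⇒nonloop : ∀ {x y} → ¬ Parallel M x y → Indep M ⁅ y ⁆
  nonparallel⇒nonloop {x} {y} x∦y = indep-hereditary (q⊆p∪q ⁅ x ⁆ ⁅ y ⁆) (proj₂ (nonparallel-pair x∦y))

  module WithRank (r : ℕ) (hasRank : HasRank M r) where
    private
      B₀ : Subset n
      B₀ = proj₁ hasRank
      basis-B₀ : IsBasis M B₀
      basis-B₀ = proj₁ (proj₂ hasRank)
      |B₀|≡r : ∣ B₀ ∣ ≡ r
      |B₀|≡r = proj₂ (proj₂ hasRank)

    basis-card : ∀ {B} → IsBasis M B → ∣ B ∣ ≡ r
    basis-card basis-B =
      ≡.trans (ℕP.≤-antisym (basis-max basis-B₀ (proj₁ basis-B)) (basis-max basis-B (proj₁ basis-B₀))) |B₀|≡r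

    indep-≤r : ∀ {I} → Indep M I → ∣ I ∣ ≤ r
    indep-≤r indep-I = ≡.subst (_ ≤_) |B₀|≡r (basis-max basis-B₀ indep-I)

    r≤n : r ≤ n
    r≤n = ≡.subst (_≤ n) |B₀|≡r (∣p∣≤n B₀)

    nonloop-exists : 0 < r → ∃ λ l → Indep M ⁅ l ⁆
    nonloop-exists 0<r with ∣ B₀ ∣ in eq
    ... | suc _ with nonempty B₀ eq
    ...   | l , l∈B₀ = l , member-nonloop (proj₁ basis-B₀) l∈B₀
    nonloop-exists 0<r | zero with ≡.subst (0 <_) (≡.trans (≡.sym |B₀|≡r) eq) 0<r
    ... | ()

    indep-r⇒basis : ∀ {I} → Indep M I → ∣ I ∣ ≡ r → IsBasis M I
    indep-r⇒basis {I} indep-I |I|≡r = indep-I , λ (B′ , I⊆B′ , indep-B′ , B′≢I) →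
      ℕP.<-irrefl ≡.refl
        (ℕP.<-≤-trans (≡.subst (_< ∣ B′ ∣) |I|≡r (⊆∧≢⇒∣<∣ I⊆B′ (B′≢I ∘ ≡.sym))) (indep-≤r indep-B′))

    extend-to-basis : ∀ {I} → Indep M I → ∃ λ B → IsBasis M B × I ⊆ B
    extend-to-basis {I} indep-I = go (r ∸ ∣ I ∣) indep-I (ℕP.m∸n+n≡m (indep-≤r indep-I))
      where
      go : ∀ k {J} → Indep M J → k ℕ.+ ∣ J ∣ ≡ r → ∃ λ B → IsBasis M B × J ⊆ B
      go zero indep-J |J|≡r = _ , indep-r⇒basis indep-J |J|≡r , λ x∈J → x∈J
      go (suc k) {J} indep-J k+1+|J|≡r with indep-augment indep-J (proj₁ basis-B₀) |J|<|B₀|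
        where
        |J|<|B₀| : ∣ J ∣ < ∣ B₀ ∣
        |J|<|B₀| = ≡.subst (∣ J ∣ <_) (≡.trans k+1+|J|≡r (≡.sym |B₀|≡r)) (ℕP.m<n+m ∣ J ∣ {suc k} (s≤s z≤n))
      ... | x , _ , x∉J , indep-J+x
          with go k indep-J+x (≡.trans (≡.cong (k ℕ.+_) (card-add J x x∉J)) (≡.trans (ℕP.+-suc k ∣ J ∣) k+1+|J|≡r))
      ...   | B , basis-B , J+x⊆B = B , basis-B , λ x∈J → J+x⊆B (p⊆p∪q ⁅ x ⁆ x∈J)

    uniform-criterion : (∀ J → Indep M J → ∣ J ∣ < r → ∀ l → l ∉ J → Indep M (J ∪ ⁅ l ⁆)) → IsUniform M r
    uniform-criterion extends B = basis-card , λ |B|≡r → indep-r⇒basis (small-indep r ℕP.≤-refl B |B|≡r) |B|≡r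
      where
      small-indep : ∀ k → k ≤ r → ∀ S → ∣ S ∣ ≡ k → Indep M S
      small-indep zero _ S |S|≡0 rewrite card-zero S |S|≡0 = indep-⊥
      small-indep (suc k) k<r S |S|≡1+k with nonempty S |S|≡1+k
      ... | x , x∈S = ≡.subst (Indep M) (remove-add x∈S)
            (extends (S ∖ x) (small-indep k (ℕP.<⇒≤ k<r) (S ∖ x) |S∖x|≡k) (≡.subst (_< r) (≡.sym |S∖x|≡k) k<r) x (x∉p∖x x S))
        where
        |S∖x|≡k : ∣ S ∖ x ∣ ≡ k
        |S∖x|≡k = ℕP.suc-injective (≡.trans (card-remove x∈S) |S|≡1+k)

module BasisPolynomial {c ℓ₁ ℓ₂} (ℝ : Reals c ℓ₁ ℓ₂) {n : ℕ} (M : Matroid n) where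
  open OrderedField ℝ
  open Operators ℝ
  open Poly ℝ using (f; ∂)
  open Subsets
  open MatroidFacts M

  W : Subset n → Fin n → Carrier
  W S k = ∂ k (f M) (exponent S)

  f-exponent : ∀ S → f M (exponent S) ≡ (if does (isBasis? M S) then 1# else 0#)
  f-exponent S rewrite toSubset-exponent S = ≡.refl

  f-basis : ∀ {S} → IsBasis M S → f M (exponent S) ≈ 1#
  f-basis {S} basis rewrite f-exponent S | dec-true (isBasis? M S) basis = refl

  f-nonbasis : ∀ {S} → ¬ IsBasis M S → f M (exponent S) ≈ 0#
  f-nonbasis {S} nonbasis rewrite f-exponent S | dec-false (isBasis? M S) nonbasis = refl

  W-∈ : ∀ {S k} → k ∈ S → W S k ≈ 0#
  W-∈ {S} {k} k∈S rewrite bump-∈ S k k∈S = zeroʳ _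

  W-∉ : ∀ {S k} → k ∉ S → W S k ≈ f M (exponent (S ∪ ⁅ k ⁆))
  W-∉ {S} {k} k∉S rewrite lookup-∉ S k k∉S | bump-∉ S k k∉S = trans (*-cong (+-identityʳ 1#) refl) (*-identityˡ _)

  W-basis : ∀ {S k} → k ∉ S → IsBasis M (S ∪ ⁅ k ⁆) → W S k ≈ 1#
  W-basis k∉S basis = trans (W-∉ k∉S) (f-basis basis)

  W-nonbasis : ∀ {S k} → k ∉ S → ¬ IsBasis M (S ∪ ⁅ k ⁆) → W S k ≈ 0#
  W-nonbasis k∉S nonbasis = trans (W-∉ k∉S) (f-nonbasis nonbasis)

  W-nonneg : ∀ S k → 0# ≤ᵣ W S k
  W-nonneg S k with k ∈? S
  ... | yes k∈S = inj₂ (sym (W-∈ k∈S))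
  ... | no k∉S with isBasis? M (S ∪ ⁅ k ⁆)
  ...   | yes basis = inj₁ (<-respʳ-≈ (sym (W-basis k∉S basis)) 0<1)
  ...   | no nonbasis = inj₂ (sym (W-nonbasis k∉S nonbasis))

  ∂f-non01 : ∀ e k → toSubset e ≡ nothing → ∂ k (f M) e ≈ 0#
  ∂f-non01 e k eq rewrite bump-nothing e k eq = zeroʳ _

  module RankTwo (r : ℕ) (hasRank : HasRank M r) (r≡2 : r ≡ 2) where
    open WithRank r hasRank

    W-parallel : ∀ {x k} → Parallel M x k → W ⁅ x ⁆ k ≈ 0#
    W-parallel {x} {k} x∥k with k ∈? ⁅ x ⁆
    ... | yes k∈x = W-∈ k∈x
    ... | no k∉x with x∥k
    ...   | inj₁ ≡.refl = ⊥-elim (k∉x (x∈⁅x⁆ x))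
    ...   | inj₂ dependent = W-nonbasis k∉x (dependent ∘ proj₁)

    W-nonparallel : ∀ {x k} → ¬ Parallel M x k → W ⁅ x ⁆ k ≈ 1#
    W-nonparallel {x} {k} x∦k with nonparallel-pair x∦k
    ... | x≢k , indep-xk = W-basis (x≢y⇒x∉⁅y⁆ (x≢k ∘ ≡.sym)) (indep-r⇒basis indep-xk (≡.trans (pair-card x≢k) (≡.sym r≡2)))

    W-parallel-rows : ∀ {x y} → Indep M ⁅ x ⁆ → Indep M ⁅ y ⁆ → Parallel M x y → ∀ k → W ⁅ x ⁆ k ≈ W ⁅ y ⁆ k
    W-parallel-rows {x} {y} indep-x indep-y x∥y k with parallel? x k
    ... | yes x∥k = trans (W-parallel x∥k) (sym (W-parallel (parallel-trans indep-x (parallel-sym x∥y) x∥k)))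
    ... | no x∦k = trans (W-nonparallel x∦k) (sym (W-nonparallel (x∦k ∘ parallel-trans indep-y x∥y)))

    W-non-singleton : ∀ {S} → ∣ S ∣ ≢ 1 → ∀ k → W S k ≈ 0#
    W-non-singleton {S} |S|≢1 k with k ∈? S
    ... | yes k∈S = W-∈ k∈S
    ... | no k∉S = W-nonbasis k∉S (λ basis →
            |S|≢1 (ℕP.suc-injective (≡.trans (≡.sym (card-add S k k∉S)) (≡.trans (basis-card basis) r≡2))))

module PartOne {c ℓ₁ ℓ₂} (ℝ : Reals c ℓ₁ ℓ₂) {n : ℕ} (M : Matroid n) (r : ℕ) (hasRank : HasRank M r) where
  open OrderedField ℝ
  open Operators ℝ
  open Poly ℝ using (f; linOp; unit; ℓ; three; IsZero; LinIndepIn; Dim1≥3)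
  open Subsets
  open MatroidFacts M
  open WithRank r hasRank
  open BasisPolynomial ℝ M

  module Coefficients (a : Fin n → Carrier) (a-pos : ∀ k → 0# <ᵣ a k) (i j : Fin n) (cs : Fin 3 → Carrier)
    (annihilates : IsZero (linOp (λ k → ΣFin (λ t → cs t * three (ℓ a) (unit i) (unit j) t k)) (f M))) where

    c₀ c₁ c₂ : Carrier
    c₀ = cs zero
    c₁ = cs (suc zero)
    c₂ = cs (suc (suc zero))

    A : Subset n → Carrier
    A S = ΣFin (λ k → a k * W S k)

    A-pos : ∀ S m → W S m ≈ 1# → 0# <ᵣ A S
    A-pos S m Wm≈1 = <-respˡ-≈ (Σ-0 {n}) (Σ-mono-< (λ k → *-nonneg (inj₁ (a-pos k)) (W-nonneg S k)) m
                                    (<-respʳ-≈ (sym (trans (*-cong refl Wm≈1) (*-identityʳ (a m)))) (a-pos m)))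

    equation : ∀ S {x y} → W S i ≈ x → W S j ≈ y → c₀ * A S + (c₁ * x + c₂ * y) ≈ 0#
    equation S {x} {y} Wi≈x Wj≈y = begin
      c₀ * A S + (c₁ * x + c₂ * y)
        ≈⟨ +-cong refl (+-cong (*-cong refl (trans (sym Wi≈x) (sym (linOp-unit i (f M) e))))
                               (trans (*-cong refl (trans (sym Wj≈y) (sym (linOp-unit j (f M) e)))) (sym (+-identityʳ _)))) ⟩
      ΣFin (λ t → cs t * linOp (three (ℓ a) (unit i) (unit j) t) (f M) e)
        ≈⟨ sym (linOp-combination cs (three (ℓ a) (unit i) (unit j)) (f M) e) ⟩
      linOp (λ k → ΣFin (λ t → cs t * three (ℓ a) (unit i) (unit j) t k)) (f M) e
        ≈⟨ annihilates e ⟩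
      0# ∎
      where
      e : Vec ℕ n
      e = exponent S

    without-c₀ : ∀ S {x y} → c₀ ≈ 0# → W S i ≈ x → W S j ≈ y → c₁ * x + c₂ * y ≈ 0#
    without-c₀ S c₀≈0 Wi≈x Wj≈y =
      trans (sym (trans (+-cong (trans (*-cong c₀≈0 refl) (zeroˡ _)) refl) (+-identityˡ _))) (equation S Wi≈x Wj≈y)

    c₀≈0-at : ∀ S m → W S i ≈ 0# → W S j ≈ 0# → W S m ≈ 1# → c₀ ≈ 0#
    c₀≈0-at S m Wi≈0 Wj≈0 Wm≈1 = cancelʳ c₀A≈0 (<⇒≉ (A-pos S m Wm≈1) ∘ sym)
      where
      c₀A≈0 : c₀ * A S ≈ 0#
      c₀A≈0 = trans (sym (trans (+-cong refl (trans (+-cong (zeroʳ c₁) (zeroʳ c₂)) (+-identityʳ 0#))) (+-identityʳ _)))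
                    (equation S Wi≈0 Wj≈0)

    c₁≈0-at : ∀ S → c₀ ≈ 0# → W S i ≈ 1# → W S j ≈ 0# → c₁ ≈ 0#
    c₁≈0-at S c₀≈0 Wi≈1 Wj≈0 =
      trans (sym (trans (+-cong (*-identityʳ c₁) (zeroʳ c₂)) (+-identityʳ c₁))) (without-c₀ S c₀≈0 Wi≈1 Wj≈0)

    c₂≈0-at : ∀ S → c₀ ≈ 0# → W S i ≈ 0# → W S j ≈ 1# → c₂ ≈ 0#
    c₂≈0-at S c₀≈0 Wi≈0 Wj≈1 =
      trans (sym (trans (+-cong (zeroʳ c₁) (*-identityʳ c₂)) (+-identityˡ c₂))) (without-c₀ S c₀≈0 Wi≈0 Wj≈1)

    all-zero : c₀ ≈ 0# → c₁ ≈ 0# → c₂ ≈ 0# → ∀ t → cs t ≈ 0#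
    all-zero c₀≈0 _ _ zero = c₀≈0
    all-zero _ c₁≈0 _ (suc zero) = c₁≈0
    all-zero _ _ c₂≈0 (suc (suc zero)) = c₂≈0

    -- Rank ≥ 3: extend {i, j} to a basis B with a third element m and use the
    -- sets B - m, B - i, B - j.
    rank≥3 : ¬ Parallel M i j → 3 ≤ r → ∀ t → cs t ≈ 0#
    rank≥3 i∦j 3≤r with nonparallel-pair i∦j
    ... | i≢j , indep-ij with extend-to-basis indep-ij
    ...   | B , basis-B , ij⊆B = all-zero c₀≈0 c₁≈0 c₂≈0
      where
      i∈B : i ∈ B
      i∈B = ij⊆B (x∈p∪q⁺ (inj₁ (x∈⁅x⁆ i)))
      j∈B : j ∈ B
      j∈B = ij⊆B (x∈p∪q⁺ (inj₂ (x∈⁅x⁆ j)))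
      j∈B∖i : j ∈ B ∖ i
      j∈B∖i = x∈p∧x≢y⇒x∈p-y j∈B (i≢j ∘ ≡.sym)

      B∖x+x-basis : ∀ {x} → x ∈ B → IsBasis M ((B ∖ x) ∪ ⁅ x ⁆)
      B∖x+x-basis x∈B = ≡.subst (IsBasis M) (≡.sym (remove-add x∈B)) basis-B

      |B∖i∖j|+2≡r : suc (suc ∣ (B ∖ i) ∖ j ∣) ≡ r
      |B∖i∖j|+2≡r = ≡.trans (≡.cong suc (card-remove j∈B∖i)) (≡.trans (card-remove i∈B) (basis-card basis-B))

      third : Nonempty ((B ∖ i) ∖ j)
      third with ∣ (B ∖ i) ∖ j ∣ in eq
      ... | suc _ = nonempty _ eq
      ... | zero with ≡.subst (3 ≤_) (≡.sym (≡.trans (≡.cong (λ s → suc (suc s)) (≡.sym eq)) |B∖i∖j|+2≡r)) 3≤r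
      ...   | s≤s (s≤s ())

      m : Fin n
      m = proj₁ third
      m∈B∖i : m ∈ B ∖ i
      m∈B∖i = p─q⊆p (B ∖ i) ⁅ j ⁆ (proj₂ third)
      m∈B : m ∈ B
      m∈B = p─q⊆p B ⁅ i ⁆ m∈B∖i
      i≢m : i ≢ m
      i≢m i≡m = x∉p∖x i B (≡.subst (_∈ B ∖ i) (≡.sym i≡m) m∈B∖i)
      j≢m : j ≢ m
      j≢m j≡m = x∉p∖x j (B ∖ i) (≡.subst (_∈ (B ∖ i) ∖ j) (≡.sym j≡m) (proj₂ third))

      c₀≈0 : c₀ ≈ 0#
      c₀≈0 = c₀≈0-at (B ∖ m) m (W-∈ (x∈p∧x≢y⇒x∈p-y i∈B i≢m)) (W-∈ (x∈p∧x≢y⇒x∈p-y j∈B j≢m))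
                                (W-basis (x∉p∖x m B) (B∖x+x-basis m∈B))
      c₁≈0 : c₁ ≈ 0#
      c₁≈0 = c₁≈0-at (B ∖ i) c₀≈0 (W-basis (x∉p∖x i B) (B∖x+x-basis i∈B)) (W-∈ j∈B∖i)
      c₂≈0 : c₂ ≈ 0#
      c₂≈0 = c₂≈0-at (B ∖ j) c₀≈0 (W-∈ (x∈p∧x≢y⇒x∈p-y i∈B i≢j)) (W-basis (x∉p∖x j B) (B∖x+x-basis j∈B))

    -- Rank 2 with an element k parallel to neither i nor j: the equations at
    -- {i}, {j}, {k} give c₀ (A{i} + A{j}) = c₀ A{k}, while A{k} < A{i} + A{j}.
    third-class : r ≡ 2 → ¬ Parallel M i j → ∀ k → ¬ Parallel M i k → ¬ Parallel M j k → ∀ t → cs t ≈ 0#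
    third-class r≡2 i∦j k i∦k j∦k = all-zero c₀≈0 (c₁≈0-at ⁅ j ⁆ c₀≈0 Wji Wjj) (c₂≈0-at ⁅ i ⁆ c₀≈0 Wii Wij)
      where
      open RankTwo r hasRank r≡2

      Wij : W ⁅ i ⁆ j ≈ 1#
      Wij = W-nonparallel i∦j
      Wji : W ⁅ j ⁆ i ≈ 1#
      Wji = W-nonparallel (i∦j ∘ parallel-sym)
      Wii : W ⁅ i ⁆ i ≈ 0#
      Wii = W-∈ (x∈⁅x⁆ i)
      Wjj : W ⁅ j ⁆ j ≈ 0#
      Wjj = W-∈ (x∈⁅x⁆ j)

      row-k≤ : ∀ l → W ⁅ k ⁆ l ≤ᵣ (W ⁅ i ⁆ l + W ⁅ j ⁆ l)
      row-k≤ l with parallel? k l | parallel? i l | parallel? j l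
      ... | yes k∥l | _ | _ = ≤-resp-≈ (trans (+-identityʳ 0#) (sym (W-parallel k∥l))) refl (+-mono-≤ (W-nonneg ⁅ i ⁆ l) (W-nonneg ⁅ j ⁆ l))
      ... | no k∦l | no i∦l | _ =
            ≤-resp-≈ (trans (+-identityʳ 1#) (sym (W-nonparallel k∦l))) (+-cong (sym (W-nonparallel i∦l)) refl)
                     (+-mono-≤ (inj₂ refl) (W-nonneg ⁅ j ⁆ l))
      ... | no k∦l | yes _ | no j∦l =
            ≤-resp-≈ (trans (+-identityˡ 1#) (sym (W-nonparallel k∦l))) (+-cong refl (sym (W-nonparallel j∦l)))
                     (+-mono-≤ (W-nonneg ⁅ i ⁆ l) (inj₂ refl))
      ... | no k∦l | yes i∥l | yes j∥l = ⊥-elim (i∦j (parallel-trans (nonparallel⇒nonloop k∦l) i∥l (parallel-sym j∥l)))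

      row-k<k : W ⁅ k ⁆ k <ᵣ (W ⁅ i ⁆ k + W ⁅ j ⁆ k)
      row-k<k = <-respˡ-≈ (trans (+-identityʳ 0#) (sym (W-∈ (x∈⁅x⁆ k))))
                  (+-mono-<-≤ (<-respʳ-≈ (sym (W-nonparallel i∦k)) 0<1) (W-nonneg ⁅ j ⁆ k))

      Ak<Ai+Aj : A ⁅ k ⁆ <ᵣ (A ⁅ i ⁆ + A ⁅ j ⁆)
      Ak<Ai+Aj = <-respʳ-≈ (Σ-+ (λ l → a l * W ⁅ i ⁆ l) (λ l → a l * W ⁅ j ⁆ l))
                   (Σ-mono-< (λ l → ≤-resp-≈ refl (distribˡ (a l) _ _) (*-monoˡ-≤ (inj₁ (a-pos l)) (row-k≤ l))) k
                             (<-respʳ-≈ (distribˡ (a k) _ _) (*-monoˡ-< (a-pos k) row-k<k)))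

      at-i : c₀ * A ⁅ i ⁆ + c₂ ≈ 0#
      at-i = trans (+-cong refl (sym (trans (+-cong (zeroʳ c₁) (*-identityʳ c₂)) (+-identityˡ c₂)))) (equation ⁅ i ⁆ Wii Wij)
      at-j : c₀ * A ⁅ j ⁆ + c₁ ≈ 0#
      at-j = trans (+-cong refl (sym (trans (+-cong (*-identityʳ c₁) (zeroʳ c₂)) (+-identityʳ c₁)))) (equation ⁅ j ⁆ Wji Wjj)
      at-k : c₀ * A ⁅ k ⁆ + (c₂ + c₁) ≈ 0#
      at-k = trans (+-cong refl (trans (+-comm c₂ c₁) (sym (+-cong (*-identityʳ c₁) (*-identityʳ c₂)))))
                   (equation ⁅ k ⁆ (W-nonparallel (i∦k ∘ parallel-sym)) (W-nonparallel (j∦k ∘ parallel-sym)))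

      c₀≈0 : c₀ ≈ 0#
      c₀≈0 = *-cancel-≉ (+-cancelʳ (c₂ + c₁) _ _ (begin
        c₀ * (A ⁅ i ⁆ + A ⁅ j ⁆) + (c₂ + c₁)         ≈⟨ +-cong (distribˡ c₀ _ _) refl ⟩
        (c₀ * A ⁅ i ⁆ + c₀ * A ⁅ j ⁆) + (c₂ + c₁)   ≈⟨ interchange _ _ _ _ ⟩
        (c₀ * A ⁅ i ⁆ + c₂) + (c₀ * A ⁅ j ⁆ + c₁)   ≈⟨ +-cong at-i at-j ⟩
        0# + 0#                                     ≈⟨ +-identityʳ 0# ⟩
        0#                                          ≈⟨ sym at-k ⟩
        c₀ * A ⁅ k ⁆ + (c₂ + c₁)                     ∎)) (<⇒≉ Ak<Ai+Aj ∘ sym)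

  -- Rank 2 with every element parallel to i or to j: an operator annihilates
  -- f_M as soon as it vanishes at x^{i} and x^{j}, hence dim R¹_{f_M} ≤ 2.
  module NoThirdClass (r≡2 : r ≡ 2) {i j : Fin n} (i∦j : ¬ Parallel M i j)
    (no-third : ¬ (∃ λ k → ¬ Parallel M i k × ¬ Parallel M j k)) where
    open RankTwo r hasRank r≡2

    annihilates-if-zero-at-i-j : ∀ d → linOp d (f M) (exponent ⁅ i ⁆) ≈ 0# → linOp d (f M) (exponent ⁅ j ⁆) ≈ 0# →
                                 IsZero (linOp d (f M))
    annihilates-if-zero-at-i-j d at-i at-j e with toSubset e in eq
    ... | nothing = trans (Σ-cong (λ k → trans (*-cong refl (∂f-non01 e k eq)) (zeroʳ (d k)))) (Σ-0 {n})
    ... | just S = ≡.subst (λ e′ → linOp d (f M) e′ ≈ 0#) (≡.sym (toSubset-just e eq)) (at S)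
      where
      zero-row : ∀ {S} → (∀ k → W S k ≈ 0#) → linOp d (f M) (exponent S) ≈ 0#
      zero-row W≈0 = trans (Σ-cong (λ k → trans (*-cong refl (W≈0 k)) (zeroʳ (d k)))) (Σ-0 {n})

      same-row : ∀ {x y} → (∀ k → W ⁅ x ⁆ k ≈ W ⁅ y ⁆ k) → linOp d (f M) (exponent ⁅ y ⁆) ≈ 0# →
                 linOp d (f M) (exponent ⁅ x ⁆) ≈ 0#
      same-row rows≈ at-y = trans (Σ-cong (λ k → *-cong refl (rows≈ k))) at-y

      indep-i : Indep M ⁅ i ⁆
      indep-i = nonparallel⇒nonloop (i∦j ∘ parallel-sym)

      at-singleton : ∀ l → linOp d (f M) (exponent ⁅ l ⁆) ≈ 0#
      at-singleton l with indep? M ⁅ l ⁆ | parallel? i l | parallel? j l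
      ... | no loop | _ | _ = zero-row {⁅ l ⁆} (λ k → W-parallel (loop-parallel k loop))
      ... | yes indep-l | yes i∥l | _ = same-row {l} {i} (W-parallel-rows {l} {i} indep-l indep-i (parallel-sym i∥l)) at-i
      ... | yes indep-l | no _ | yes j∥l = same-row {l} {j} (W-parallel-rows {l} {j} indep-l (nonparallel⇒nonloop i∦j) (parallel-sym j∥l)) at-j
      ... | yes _ | no i∦l | no j∦l = ⊥-elim (no-third (l , i∦l , j∦l))

      at : ∀ S → linOp d (f M) (exponent S) ≈ 0#
      at S with ∣ S ∣ ℕ.≟ 1
      ... | no |S|≢1 = zero-row {S} (W-non-singleton {S} |S|≢1)
      ... | yes |S|≡1 with singleton-of-card S |S|≡1
      ...   | l , ≡.refl = at-singleton l

    dim≤2 : ¬ Dim1≥3 (f M)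
    dim≤2 (v , independent) with common-zero (λ t → linOp (v t) (f M) (exponent ⁅ i ⁆)) (λ t → linOp (v t) (f M) (exponent ⁅ j ⁆))
    ... | cs , at-i , at-j , t , cs-t≉0 = cs-t≉0 (independent cs (annihilates-if-zero-at-i-j _
            (trans (linOp-combination cs v (f M) (exponent ⁅ i ⁆)) at-i)
            (trans (linOp-combination cs v (f M) (exponent ⁅ j ⁆)) at-j)) t)

  rank-two : 2 ≤ r → ¬ (3 ≤ r) → r ≡ 2
  rank-two 2≤r 3≰r = ℕP.≤-antisym (ℕP.≤-pred (ℕP.≰⇒> 3≰r)) 2≤r

  part-one : 2 ≤ r → (a : Fin n → Carrier) → (∀ k → 0# <ᵣ a k) → (i j : Fin n) → Dim1≥3 (f M) → ¬ Parallel M i j →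
             LinIndepIn (f M) (three (ℓ a) (unit i) (unit j))
  part-one 2≤r a a-pos i j dim i∦j cs annihilates with 3 ℕP.≤? r
  ... | yes 3≤r = Coefficients.rank≥3 a a-pos i j cs annihilates i∦j 3≤r
  ... | no 3≰r with any? (λ k → ¬? (parallel? i k) ×-dec ¬? (parallel? j k))
  ...   | yes (k , i∦k , j∦k) = Coefficients.third-class a a-pos i j cs annihilates (rank-two 2≤r 3≰r) i∦j k i∦k j∦k
  ...   | no no-third = ⊥-elim (NoThirdClass.dim≤2 (rank-two 2≤r 3≰r) i∦j no-third dim)

module IndependencePolynomial {c ℓ₁ ℓ₂} (ℝ : Reals c ℓ₁ ℓ₂) {n : ℕ} (M : Matroid n) where
  open OrderedField ℝ
  open Operators ℝ
  open Poly ℝ using (Pol; P; Pbar; ∂; iter)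
  open Subsets

  -- rising e s = (e+1)(e+2)⋯(e+s), the factor produced by ∂₀^s on x₀^{e+s}
  rising : ℕ → ℕ → Carrier
  rising e zero = 1#
  rising e (suc s) = fromℕ (suc e) * rising (suc e) s

  rising-pos : ∀ e s → 0# <ᵣ rising e s
  rising-pos e zero = 0<1
  rising-pos e (suc s) = *-pos (fromℕ-pos {suc e} (s≤s z≤n)) (rising-pos (suc e) s)

  rising-suc : ∀ e s → rising e (suc s) ≈ rising e s * fromℕ (suc (s ℕ.+ e))
  rising-suc e zero = trans (*-identityʳ _) (sym (*-identityˡ _))
  rising-suc e (suc s) = begin
    fromℕ (suc e) * rising (suc e) (suc s)                        ≈⟨ *-cong refl (rising-suc (suc e) s) ⟩
    fromℕ (suc e) * (rising (suc e) s * fromℕ (suc (s ℕ.+ suc e))) ≈⟨ sym (*-assoc _ _ _) ⟩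
    rising e (suc s) * fromℕ (suc (s ℕ.+ suc e))                  ≈⟨ *-cong refl (≡⇒≈ (≡.cong (fromℕ ∘ suc) (ℕP.+-suc s e))) ⟩
    rising e (suc s) * fromℕ (suc (suc s ℕ.+ e))                  ∎

  iter-∂₀ : ∀ s (p : Pol (suc n)) e₀ e → iter s (∂ zero) p (e₀ ∷ e) ≈ rising e₀ s * p ((s ℕ.+ e₀) ∷ e)
  iter-∂₀ zero p e₀ e = sym (*-identityˡ _)
  iter-∂₀ (suc s) p e₀ e = begin
    fromℕ (suc e₀) * iter s (∂ zero) p (suc e₀ ∷ e)                ≈⟨ *-cong refl (iter-∂₀ s p (suc e₀) e) ⟩
    fromℕ (suc e₀) * (rising (suc e₀) s * p ((s ℕ.+ suc e₀) ∷ e))   ≈⟨ sym (*-assoc _ _ _) ⟩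
    rising e₀ (suc s) * p ((s ℕ.+ suc e₀) ∷ e)                      ≈⟨ *-cong refl (≡⇒≈ (≡.cong (λ z → p (z ∷ e)) (ℕP.+-suc s e₀))) ⟩
    rising e₀ (suc s) * p ((suc s ℕ.+ e₀) ∷ e)                      ∎

  P-exponent : ∀ e₀ J → P M (e₀ ∷ exponent J) ≡ (if does (indep? M J) ∧ does (e₀ ℕ.≟ (n ∸ ∣ J ∣)) then 1# else 0#)
  P-exponent e₀ J rewrite toSubset-exponent J = ≡.refl

  P-indep : ∀ {e₀ J} → Indep M J → e₀ ≡ n ∸ ∣ J ∣ → P M (e₀ ∷ exponent J) ≈ 1#
  P-indep {e₀} {J} indep-J e₀≡ rewrite P-exponent e₀ J | dec-true (indep? M J) indep-J | dec-true (e₀ ℕ.≟ (n ∸ ∣ J ∣)) e₀≡ = refl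

  P-dep : ∀ {e₀ J} → ¬ Indep M J → P M (e₀ ∷ exponent J) ≈ 0#
  P-dep {e₀} {J} dependent rewrite P-exponent e₀ J | dec-false (indep? M J) dependent = refl

  V : Subset n → Fin n → Carrier
  V J k = ∂ (suc k) (P M) ((n ∸ suc ∣ J ∣) ∷ exponent J)

  V-∈ : ∀ {J k} → k ∈ J → V J k ≈ 0#
  V-∈ {J} {k} k∈J rewrite bump-∈ J k k∈J = zeroʳ _

  V-∉ : ∀ {J k} → k ∉ J → V J k ≈ P M ((n ∸ suc ∣ J ∣) ∷ exponent (J ∪ ⁅ k ⁆))
  V-∉ {J} {k} k∉J rewrite lookup-∉ J k k∉J | bump-∉ J k k∉J = trans (*-cong (+-identityʳ 1#) refl) (*-identityˡ _)

  V-indep : ∀ {J k} → k ∉ J → Indep M (J ∪ ⁅ k ⁆) → V J k ≈ 1#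
  V-indep {J} {k} k∉J indep = trans (V-∉ k∉J) (P-indep indep (≡.cong (n ∸_) (≡.sym (card-add J k k∉J))))

  V-dep : ∀ {J k} → k ∉ J → ¬ Indep M (J ∪ ⁅ k ⁆) → V J k ≈ 0#
  V-dep k∉J dependent = trans (V-∉ k∉J) (P-dep dependent)

  V-cases : ∀ J k → (V J k ≈ 0#) ⊎ (V J k ≈ 1# × k ∉ J × Indep M (J ∪ ⁅ k ⁆))
  V-cases J k with k ∈? J
  ... | yes k∈J = inj₁ (V-∈ k∈J)
  ... | no k∉J with indep? M (J ∪ ⁅ k ⁆)
  ...   | yes indep = inj₂ (V-indep k∉J indep , k∉J , indep)
  ...   | no dependent = inj₁ (V-dep k∉J dependent)

  V-nonneg : ∀ J k → 0# ≤ᵣ V J k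
  V-nonneg J k with V-cases J k
  ... | inj₁ V≈0 = inj₂ (sym V≈0)
  ... | inj₂ (V≈1 , _) = inj₁ (<-respʳ-≈ (sym V≈1) 0<1)

  module AtIndependent (r : ℕ) (r≤n : r ≤ n) {J : Subset n} (indep-J : Indep M J) (|J|<r : ∣ J ∣ < r) where
    e₀ : ℕ
    e₀ = r ∸ suc ∣ J ∣

    s : ℕ
    s = n ∸ r

    s+e₀≡ : s ℕ.+ e₀ ≡ n ∸ suc ∣ J ∣
    s+e₀≡ = ≡.trans (≡.sym (ℕP.+-∸-assoc s |J|<r)) (≡.cong (_∸ suc ∣ J ∣) (ℕP.m∸n+n≡m r≤n))

    1+s+e₀≡ : suc (s ℕ.+ e₀) ≡ n ∸ ∣ J ∣
    1+s+e₀≡ = ≡.trans (≡.cong suc s+e₀≡) (≡.sym (ℕP.+-∸-assoc 1 (ℕP.≤-trans |J|<r r≤n)))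

    ∂₀-P̄ : ∂ zero (Pbar M r) (e₀ ∷ exponent J) ≈ rising e₀ s * fromℕ (n ∸ ∣ J ∣)
    ∂₀-P̄ = begin
      iter (suc s) (∂ zero) (P M) (e₀ ∷ exponent J)          ≈⟨ iter-∂₀ (suc s) (P M) e₀ (exponent J) ⟩
      rising e₀ (suc s) * P M ((suc s ℕ.+ e₀) ∷ exponent J)  ≈⟨ *-cong (rising-suc e₀ s) (P-indep indep-J 1+s+e₀≡) ⟩
      (rising e₀ s * fromℕ (suc (s ℕ.+ e₀))) * 1#            ≈⟨ trans (*-identityʳ _) (*-cong refl (≡⇒≈ (≡.cong fromℕ 1+s+e₀≡))) ⟩
      rising e₀ s * fromℕ (n ∸ ∣ J ∣)                        ∎

    ∂ₖ-P̄ : ∀ k → ∂ (suc k) (Pbar M r) (e₀ ∷ exponent J) ≈ rising e₀ s * V J k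
    ∂ₖ-P̄ k = begin
      m * iter s (∂ zero) (P M) (e₀ ∷ bumped)               ≈⟨ *-cong refl (iter-∂₀ s (P M) e₀ bumped) ⟩
      m * (rising e₀ s * P M ((s ℕ.+ e₀) ∷ bumped))         ≈⟨ x∙yz≈y∙xz m _ _ ⟩
      rising e₀ s * (m * P M ((s ℕ.+ e₀) ∷ bumped))         ≈⟨ *-cong refl (≡⇒≈ (≡.cong (λ z → m * P M (z ∷ bumped)) s+e₀≡)) ⟩
      rising e₀ s * V J k                                   ∎
      where
      m : Carrier
      m = fromℕ (suc (lookup (exponent J) k))
      bumped : Vec ℕ n
      bumped = exponent J [ k ]%= suc

module PartTwo {c ℓ₁ ℓ₂} (ℝ : Reals c ℓ₁ ℓ₂) {n : ℕ} (M : Matroid n) (r : ℕ) (hasRank : HasRank M r) (2≤r : 2 ≤ r) where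
  open OrderedField ℝ
  open Operators ℝ
  open Poly ℝ using (Pbar; ∂; linOp; unit; ℓ₀; two; IsZero; LinIndepIn)
  open Subsets
  open Matroid M using (indep-⊥; indep-hereditary)
  open MatroidFacts M
  open WithRank r hasRank
  open IndependencePolynomial ℝ M

  0<n : 0 < n
  0<n = ℕP.<-≤-trans (s≤s z≤n) (ℕP.≤-trans 2≤r r≤n)

  |⊥|<r : ∣ ⊥ {n = n} ∣ < r
  |⊥|<r rewrite ∣⊥∣≡0 n = ℕP.<-≤-trans (s≤s z≤n) 2≤r

  |⁅l⁆|<r : ∀ (l : Fin n) → ∣ ⁅ l ⁆ ∣ < r
  |⁅l⁆|<r l rewrite ∣⁅x⁆∣≡1 l = 2≤r

  V⊥-nonloop : ∀ {l} → Indep M ⁅ l ⁆ → V ⊥ l ≈ 1#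
  V⊥-nonloop {l} indep-l = V-indep ∉⊥ (≡.subst (Indep M) (≡.sym (∪-identityˡ ⁅ l ⁆)) indep-l)

  fromℕ-∸-* : ∀ {k} x → k < n → fromℕ (n ∸ k) * x ≈ x + fromℕ (n ∸ suc k) * x
  fromℕ-∸-* {k} x k<n = begin
    fromℕ (n ∸ k) * x                ≈⟨ *-cong (≡⇒≈ (≡.cong fromℕ (ℕP.+-∸-assoc 1 k<n))) refl ⟩
    (1# + fromℕ (n ∸ suc k)) * x     ≈⟨ distribʳ x 1# _ ⟩
    1# * x + fromℕ (n ∸ suc k) * x   ≈⟨ +-cong (*-identityˡ x) refl ⟩
    x + fromℕ (n ∸ suc k) * x        ∎

  module Coefficients (a : Fin n → Carrier) (a-pos : ∀ k → 0# <ᵣ a k) (cs : Fin 2 → Carrier)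
    (annihilates : IsZero (linOp (λ k → ΣFin (λ t → cs t * two (unit zero) (ℓ₀ a) t k)) (Pbar M r))) where

    c₀ c₁ : Carrier
    c₀ = cs zero
    c₁ = cs (suc zero)

    -- the ℓ_a-part of the coefficient equation at J, up to a positive factor
    A : Subset n → Carrier
    A J = ΣFin (λ k → a k * V J k)

    -- At x₀^{e₀} x^J the operator applied to P̄_M gives R (c₀(n - |J|) + c₁A(J))
    -- with R = rising e₀ (n - r) > 0.
    equation : ∀ {J} → Indep M J → ∣ J ∣ < r → c₀ * fromℕ (n ∸ ∣ J ∣) + c₁ * A J ≈ 0#
    equation {J} indep-J |J|<r = cancelˡ R[c₀N+c₁A]≈0 (<⇒≉ (rising-pos e₀ s) ∘ sym)
      where
      open AtIndependent r r≤n indep-J |J|<r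
      E : Vec ℕ (suc n)
      E = e₀ ∷ exponent J
      R N : Carrier
      R = rising e₀ s
      N = fromℕ (n ∸ ∣ J ∣)
      R[c₀N+c₁A]≈0 : R * (c₀ * N + c₁ * A J) ≈ 0#
      R[c₀N+c₁A]≈0 = begin
        R * (c₀ * N + c₁ * A J)
          ≈⟨ distribˡ R _ _ ⟩
        R * (c₀ * N) + R * (c₁ * A J)
          ≈⟨ +-cong (x∙yz≈y∙xz R c₀ N) (trans (x∙yz≈y∙xz R c₁ (A J)) (*-cong refl (sym (Σ-* R (λ k → a k * V J k))))) ⟩
        c₀ * (R * N) + c₁ * ΣFin (λ k → R * (a k * V J k))
          ≈⟨ +-cong (*-cong refl (sym ∂₀-P̄))
                    (*-cong refl (trans (Σ-cong (λ k → trans (x∙yz≈y∙xz R (a k) (V J k)) (*-cong refl (sym (∂ₖ-P̄ k)))))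
                                        (sym (trans (+-cong (zeroˡ _) refl) (+-identityˡ _))))) ⟩
        c₀ * ∂ zero (Pbar M r) E + c₁ * linOp (ℓ₀ a) (Pbar M r) E
          ≈⟨ +-cong (*-cong refl (sym (linOp-unit zero (Pbar M r) E))) (sym (+-identityʳ _)) ⟩
        ΣFin (λ t → cs t * linOp (two (unit zero) (ℓ₀ a) t) (Pbar M r) E)
          ≈⟨ sym (linOp-combination cs (two (unit zero) (ℓ₀ a)) (Pbar M r) E) ⟩
        linOp (λ k → ΣFin (λ t → cs t * two (unit zero) (ℓ₀ a) t k)) (Pbar M r) E
          ≈⟨ annihilates E ⟩
        0# ∎

    -- If c₁ = 0, the equation at J = ∅ reads c₀ n = 0.
    c₁≈0⇒all-zero : c₁ ≈ 0# → ∀ t → cs t ≈ 0#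
    c₁≈0⇒all-zero c₁≈0 zero = cancelʳ c₀n≈0 (<⇒≉ n-pos ∘ sym)
      where
      n-pos : 0# <ᵣ fromℕ (n ∸ ∣ ⊥ {n = n} ∣)
      n-pos rewrite ∣⊥∣≡0 n = fromℕ-pos 0<n
      c₀n≈0 : c₀ * fromℕ (n ∸ ∣ ⊥ {n = n} ∣) ≈ 0#
      c₀n≈0 = trans (sym (trans (+-cong refl (trans (*-cong c₁≈0 refl) (zeroˡ _))) (+-identityʳ _))) (equation indep-⊥ |⊥|<r)
    c₁≈0⇒all-zero c₁≈0 (suc zero) = c₁≈0

    -- If c₁ ≠ 0, then A(J) = (n - |J|) ρ for ρ = -c₀/c₁, which forces M = U_{r,n}.
    module NonzeroSlope (c₁≉0 : ¬ (c₁ ≈ 0#)) where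
      w : Carrier
      w = proj₁ (inverse c₁ c₁≉0)

      ρ : Carrier
      ρ = - (c₀ * w)

      A-formula : ∀ {J} → Indep M J → ∣ J ∣ < r → A J ≈ fromℕ (n ∸ ∣ J ∣) * ρ
      A-formula {J} indep-J |J|<r = begin
        A J                   ≈⟨ sym (*-identityˡ _) ⟩
        1# * A J              ≈⟨ *-cong (trans (sym (proj₂ (inverse c₁ c₁≉0))) (*-comm c₁ w)) refl ⟩
        (w * c₁) * A J        ≈⟨ *-assoc w c₁ (A J) ⟩
        w * (c₁ * A J)        ≈⟨ *-cong refl (+-inverseʳ-unique _ _ (equation indep-J |J|<r)) ⟩
        w * - (c₀ * N)        ≈⟨ sym (-‿distribʳ-* w _) ⟩
        - (w * (c₀ * N))      ≈⟨ -‿cong (x∙yz≈z∙yx w c₀ N) ⟩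
        - (N * (c₀ * w))      ≈⟨ -‿distribʳ-* N _ ⟩
        N * ρ                 ∎
        where
        N : Carrier
        N = fromℕ (n ∸ ∣ J ∣)

      -- A nonloop l has weight at most ρ: A(∅) ≥ A({l}) + a_l termwise.
      weight≤ρ : ∀ {l} → Indep M ⁅ l ⁆ → a l ≤ᵣ ρ
      weight≤ρ {l} indep-l = +-cancelʳ-≤ (A ⁅ l ⁆) (≤-resp-≈ (+-comm _ _) A⊥≈ρ+A⁅l⁆ (≤-resp-≈ Σg≈ refl (Σ-mono-≤ g≤)))
        where
        g : Fin n → Carrier
        g k = a k * V ⁅ l ⁆ k + unit l k * a k
        Σg≈ : ΣFin g ≈ A ⁅ l ⁆ + a l
        Σg≈ = trans (Σ-+ (λ k → a k * V ⁅ l ⁆ k) (λ k → unit l k * a k)) (+-cong refl (Σ-unit l a))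
        V⊥l≈1 : V ⊥ l ≈ 1#
        V⊥l≈1 = V⊥-nonloop indep-l
        g≤ : ∀ k → g k ≤ᵣ (a k * V ⊥ k)
        g≤ k with k ≟ᶠ l | V-cases ⁅ l ⁆ k
        ... | yes ≡.refl | _ = inj₂ (begin
              a k * V ⁅ k ⁆ k + unit k k * a k ≈⟨ +-cong (trans (*-cong refl (V-∈ (x∈⁅x⁆ k))) (zeroʳ _)) (*-cong (unit-≡ k) refl) ⟩
              0# + 1# * a k                    ≈⟨ trans (+-identityˡ _) (trans (*-identityˡ _) (sym (*-identityʳ _))) ⟩
              a k * 1#                         ≈⟨ *-cong refl (sym V⊥l≈1) ⟩
              a k * V ⊥ k                      ∎)
        ... | no k≢l | inj₁ V≈0 =
              ≤-resp-≈ (sym (trans (+-cong (trans (*-cong refl V≈0) (zeroʳ _)) (trans (*-cong (unit-≢ k≢l) refl) (zeroˡ _)))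
                                   (+-identityʳ 0#))) refl
                       (*-nonneg (inj₁ (a-pos k)) (V-nonneg ⊥ k))
        ... | no k≢l | inj₂ (V≈1 , _ , indep-lk) = inj₂ (begin
              a k * V ⁅ l ⁆ k + unit l k * a k ≈⟨ +-cong (*-cong refl V≈1) (trans (*-cong (unit-≢ k≢l) refl) (zeroˡ _)) ⟩
              a k * 1# + 0#                    ≈⟨ +-identityʳ _ ⟩
              a k * 1#                         ≈⟨ *-cong refl (sym (V⊥-nonloop (indep-hereditary (q⊆p∪q ⁅ l ⁆ ⁅ k ⁆) indep-lk))) ⟩
              a k * V ⊥ k                      ∎)
        A⊥≈ρ+A⁅l⁆ : A ⊥ ≈ ρ + A ⁅ l ⁆
        A⊥≈ρ+A⁅l⁆ = begin
          A ⊥                              ≈⟨ A-formula indep-⊥ |⊥|<r ⟩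
          fromℕ (n ∸ ∣ ⊥ {n = n} ∣) * ρ    ≈⟨ fromℕ-∸-* ρ (≡.subst (_< n) (≡.sym (∣⊥∣≡0 n)) 0<n) ⟩
          ρ + fromℕ (n ∸ suc ∣ ⊥ {n = n} ∣) * ρ
            ≈⟨ +-cong refl (≡⇒≈ (≡.cong (λ k → fromℕ (n ∸ k) * ρ) (≡.trans (≡.cong suc (∣⊥∣≡0 n)) (≡.sym (∣⁅x⁆∣≡1 l))))) ⟩
          ρ + fromℕ (n ∸ ∣ ⁅ l ⁆ ∣) * ρ    ≈⟨ +-cong refl (sym (A-formula {⁅ l ⁆} indep-l (|⁅l⁆|<r l))) ⟩
          ρ + A ⁅ l ⁆                      ∎

      -- There is a nonloop (r > 0), hence ρ > 0.
      ρ-pos : 0# <ᵣ ρ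
      ρ-pos with nonloop-exists (ℕP.<-≤-trans (s≤s z≤n) 2≤r)
      ... | l , indep-l = <-≤-trans (a-pos l) (weight≤ρ indep-l)

      -- Comparing A(∅) = n ρ with Σₖ ρ termwise: every element is a nonloop of weight ρ.
      weighted-⊥ : ∀ k → a k * V ⊥ k ≈ ρ
      weighted-⊥ = Σ-≤-≈ term≤ρ (trans (A-formula indep-⊥ |⊥|<r)
                                       (trans (*-cong (≡⇒≈ (≡.cong (λ k → fromℕ (n ∸ k)) (∣⊥∣≡0 n))) refl) (sym (Σ-const {n} ρ))))
        where
        term≤ρ : ∀ k → (a k * V ⊥ k) ≤ᵣ ρ
        term≤ρ k with V-cases ⊥ k
        ... | inj₁ V≈0 = ≤-resp-≈ (sym (trans (*-cong refl V≈0) (zeroʳ _))) refl (inj₁ ρ-pos)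
        ... | inj₂ (V≈1 , _ , indep-k) = ≤-resp-≈ (sym (trans (*-cong refl V≈1) (*-identityʳ _))) refl
                                                   (weight≤ρ (≡.subst (Indep M) (∪-identityˡ ⁅ k ⁆) indep-k))

      weight≈ρ : ∀ k → a k ≈ ρ
      weight≈ρ k with V-cases ⊥ k
      ... | inj₁ V≈0 = ⊥-elim (<⇒≉ ρ-pos (sym (trans (sym (weighted-⊥ k)) (trans (*-cong refl V≈0) (zeroʳ _)))))
      ... | inj₂ (V≈1 , _) = trans (sym (trans (*-cong refl V≈1) (*-identityʳ _))) (weighted-⊥ k)

      -- Comparing A(J) = (n - |J|) ρ with ρ times the indicator of the
      -- complement of J termwise: every l ∉ J extends J.
      extends : ∀ J → Indep M J → ∣ J ∣ < r → ∀ l → l ∉ J → Indep M (J ∪ ⁅ l ⁆)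
      extends J indep-J |J|<r l l∉J with V-cases J l
      ... | inj₂ (_ , _ , indep) = indep
      ... | inj₁ V≈0 = ⊥-elim (<⇒≉ ρ-pos (sym (begin
            ρ                          ≈⟨ sym (*-identityˡ ρ) ⟩
            1# * ρ                     ≈⟨ *-cong (sym (indicator-∈ (x∉p⇒x∈∁p l∉J))) refl ⟩
            indicator (∁ J) l * ρ      ≈⟨ sym (weighted l) ⟩
            a l * V J l                ≈⟨ trans (*-cong refl V≈0) (zeroʳ _) ⟩
            0#                         ∎)))
        where
        term≤ : ∀ k → (a k * V J k) ≤ᵣ (indicator (∁ J) k * ρ)
        term≤ k with V-cases J k
        ... | inj₁ V≈0 = ≤-resp-≈ (sym (trans (*-cong refl V≈0) (zeroʳ _))) refl
                                  (*-nonneg (indicator-nonneg (∁ J) k) (inj₁ ρ-pos))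
        ... | inj₂ (V≈1 , k∉J , _) = inj₂ (begin
              a k * V J k              ≈⟨ trans (*-cong (weight≈ρ k) V≈1) (*-identityʳ ρ) ⟩
              ρ                        ≈⟨ sym (*-identityˡ ρ) ⟩
              1# * ρ                   ≈⟨ *-cong (sym (indicator-∈ (x∉p⇒x∈∁p k∉J))) refl ⟩
              indicator (∁ J) k * ρ    ∎)
        weighted : ∀ k → a k * V J k ≈ indicator (∁ J) k * ρ
        weighted = Σ-≤-≈ term≤ (trans (A-formula indep-J |J|<r)
                                (sym (trans (Σ-indicator (∁ J) ρ) (*-cong (≡⇒≈ (≡.cong fromℕ (∣∁p∣≡n∸∣p∣ J))) refl))))

      uniform : IsUniform M r
      uniform = uniform-criterion extends

  part-two : (a : Fin n → Carrier) → (∀ k → 0# <ᵣ a k) → ¬ IsUniform M r → LinIndepIn (Pbar M r) (two (unit zero) (ℓ₀ a))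
  part-two a a-pos nonuniform cs annihilates with cs (suc zero) ≟ᵣ 0#
  ... | yes c₁≈0 = Coefficients.c₁≈0⇒all-zero a a-pos cs annihilates c₁≈0
  ... | no c₁≉0 = ⊥-elim (nonuniform (Coefficients.NonzeroSlope.uniform a a-pos cs annihilates c₁≉0))

-- The lemma.  The non-loop hypotheses of (i) are implied by i ∦ j.
lemma4p3 : ∀ {c ℓ₁ ℓ₂ : Level} (ℝ : Reals c ℓ₁ ℓ₂) → let open Poly ℝ in
    (n r : ℕ) (M : Matroid n) → HasRank M r → 2 ≤ r →
    (a : Fin n → Carrier) → (∀ i → 0# <ᵣ a i) →
    ((i j : Fin n) → ¬ IsLoop M i → ¬ IsLoop M j → Dim1≥3 (f M) → ¬ Parallel M i j →
      LinIndepIn (f M) (three (ℓ a) (unit i) (unit j)))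
    × (¬ IsUniform M r → LinIndepIn (Pbar M r) (two (unit zero) (ℓ₀ a)))
lemma4p3 ℝ n r M hasRank 2≤r a a-pos =
  (λ i j _ _ dim i∦j → PartOne.part-one ℝ M r hasRank 2≤r a a-pos i j dim i∦j) ,
  PartTwo.part-two ℝ M r hasRank 2≤r a a-pos
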